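{- Let $(P,\preceq, \psi)$ be a pillar assignment of an interval system $\mathcal{I}$ with $\omega(\mathcal{I})=\omega$, let $K$ be an arch, let $t$ be a positive integer, and let $Q \subset K$ be a finite set of pillars of $\mathcal I$ such that $d_{(P,\preceq, \psi)}(J) \le t$ for every open interval $J$ contained in $K\setminus Q$. Then there is a pillar assignment $(P^*,\preceq^*, \psi^*)$ extending $(P,\preceq, \psi)$ such that: (1) $P^*=P\cup Q$; (2) $d_{(P^*,\preceq^*, \psi^*)}(J) \le t+ \omega \lceil \log_2(|Q|+1) \rceil$ for every open interval $J \subseteq K\setminus Q$; and (3) $\chi(P^*,\preceq^*, \psi^*) \le \max\{\chi(P,\preceq, \psi), \ d_{(P,\preceq, \psi)}(K) + \omega \lceil \log_2(|Q| + 1) \rceil\}$.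
   Context: An interval system is a finite collection $\mathcal I$ of open intervals contained in $(0,1)$ such that no two share an endpoint. For an interval $I$, $\ell(I)$, $r(I)$ are its left and right endpoints. Two distinct intervals overlap if they intersect and neither contains the other. For a set $\mathcal X$ of intervals, $\omega(\mathcal X)$ is the maximum size of a subset of pairwise overlapping intervals ($0$ if empty). A proper partial colouring of $\mathcal I$ is a map from a subset of $\mathcal I$ to the positive integers giving no two overlapping intervals the same colour. Structured colourings: if $\mathcal X\subseteq\mathcal I$ is a set of intervals all containing a common point and $C$ is a set of positive integers with $|C|=\omega(\mathcal X)$, a proper colouring $\phi:\mathcal X\to C$ is structured if (i) whenever $I_1,\dots,I_k\in\mathcal X$ satisfy $\phi(I_1)<\dots<\phi(I_k)$ and $\ell(I_1)<\dots<\ell(I_k)$, there are $k$ pairwise overlapping $I_1^*,\dots,I_k^*\in\mathcal X$ with all $\ell(I_j^*)\in[\ell(I_1),\ell(I_k)]$, and (ii) the same holds with $r$ in place of $\ell$ throughout. A pillar of $\mathcal I$ is a point of $(0,1)$ that is not an endpoint of any interval of $\mathcal I$. Let $P$ be a finite set of pillars totally ordered by $\preceq$. An interval $I\in\mathcal I$ is assigned to $p\in P$ if $p\in I$ and $I$ contains no $p'\in P$ with $p'\prec p$; $\mathcal I_p$ is the set of intervals assigned to $p$. The foundation $F_p$ is the open interval containing $p$, with endpoints in $\{p'\in P:p'\prec p\}\cup\{0,1\}$, containing no pillar $p'\prec p$; $\mathcal F_p$ is the set of intervals of $\mathcal I$ with exactly one endpoint in $F_p$. A pillar assignment is a triple $(P,\preceq,\psi)$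 with $\psi=\bigcup_{p\in P}\phi_p$, where in $\preceq$-order, with $\psi_{\prec p}=\bigcup_{p'\prec p}\phi_{p'}$, $C_p$ is the set of the $\omega(\mathcal I_p)$ smallest positive integers not in $\psi_{\prec p}(\mathcal F_p)$ and $\phi_p:\mathcal I_p\to C_p$ is a structured colouring. $\chi(P,\preceq,\psi)=|\psi(\mathcal I)|$ is the number of colours used. An arch of $(P,\preceq,\psi)$ is an open interval whose endpoints lie in $\{0,1\}\cup P$ and which contains no pillar of $P$. For an open interval $J$ contained in an arch, the degree $d_{(P,\preceq,\psi)}(J)$ is the number of distinct colours $\psi(I)$ taken over the intervals $I\in\mathcal I$ coloured by $\psi$ that have an endpoint in $J$. A pillar assignment $(P^*,\preceq^*,\psi^*)$ extends $(P,\preceq,\psi)$ if $P\subseteq P^*$, every pillar of $P$ precedes every pillar of $P^*\setminus P$ in $\preceq^*$, the restriction of $\preceq^*$ to $P$ is $\preceq$, and $\psi^*$ extends $\psi$.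
   Formalization: The endpoints of the intervals of $\mathcal I$, the pillars, the points of Q, and the endpoints of the arch K and of the open intervals J are all rational. -}

module Defs where

open import Level using (0ℓ)
open import Data.Nat as ℕ using (ℕ; _+_; _*_; _⊔_)
open import Data.Nat.Logarithm using (⌈log₂_⌉)
open import Data.Rational using (ℚ; 0ℚ; 1ℚ; _<_; _≤_; _<?_)
open import Data.Fin using (Fin)
open import Data.List using (List; []; _∷_; _++_; length; mapMaybe; allFin; deduplicate)
open import Data.List.NonEmpty using (List⁺; head; last; toList)
open import Data.List.Membership.Propositional using (_∈_; _∉_)
open import Data.List.Relation.Unary.All using (All)
open import Data.List.Relation.Unary.AllPairs using (AllPairs)
open import Data.List.Relation.Unary.Unique.Propositional using (Unique)
open import Data.Maybe using (Maybe; just; nothing)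
open import Data.Bool using (Bool; _∧_; _∨_; if_then_else_)
open import Data.Product using (Σ; ∃; ∃₂; _×_; _,_)
open import Data.Sum using (_⊎_)
open import Relation.Nullary using (¬_; does)
open import Relation.Binary.PropositionalEquality using (_≡_; _≢_)

InOpen : ℚ → ℚ → ℚ → Set
InOpen a b x = (a < x) × (x < b)

record IntervalSystem : Set where
  field
    n    : ℕ
    L R  : Fin n → ℚ
    0≤L  : ∀ i → 0ℚ ≤ L i
    L<R  : ∀ i → L i < R i
    R≤1  : ∀ i → R i ≤ 1ℚ
    noSharedEndpoint : ∀ i j → i ≢ j →
      (L i ≢ L j) × (L i ≢ R j) × (R i ≢ R j)

record FinCard (S : ℕ → Set) (k : ℕ) : Set where
  field
    elems    : List ℕ
    len      : length elems ≡ k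
    uniq     : Unique elems
    sound    : ∀ x → x ∈ elems → S x
    complete : ∀ x → S x → x ∈ elems

SmallestAvoiding : (ℕ → Set) → ℕ → (ℕ → Set) → Set
SmallestAvoiding U w C =
  FinCard C w ×
  (∀ c → C c → (1 ℕ.≤ c) × ¬ U c) ×
  (∀ c c′ → C c → 1 ℕ.≤ c′ → c′ ℕ.< c → ¬ U c′ → C c′)

InsideMinus : ℚ → ℚ → List ℚ → ℚ → ℚ → Set
InsideMinus a b Q x y = ∀ z → InOpen x y z → InOpen a b z × z ∉ Q

module _ (S : IntervalSystem) where
  open IntervalSystem S

  _∈ᴵ_ : ℚ → Fin n → Set
  x ∈ᴵ i = InOpen (L i) (R i) x

  _⊆ᴵ_ : Fin n → Fin n → Set
  i ⊆ᴵ j = ∀ x → x ∈ᴵ i → x ∈ᴵ j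

  Overlap : Fin n → Fin n → Set
  Overlap i j = (i ≢ j) × (∃ λ x → (x ∈ᴵ i) × (x ∈ᴵ j)) × ¬ (i ⊆ᴵ j) × ¬ (j ⊆ᴵ i)

  -- sets of intervals are predicates on indices
  Clique : (Fin n → Set) → ℕ → Set
  Clique X k = Σ (List (Fin n)) λ ys → (length ys ≡ k) × All X ys × AllPairs Overlap ys

  IsOmega : (Fin n → Set) → ℕ → Set
  IsOmega X w = Clique X w × (∀ k → Clique X k → k ℕ.≤ w)

  -- (partial) colourings with positive-integer colours
  Colouring : Set
  Colouring = Fin n → Maybe ℕ

  ProperOn : (Fin n → Set) → Colouring → Set
  ProperOn X ψ = ∀ i j → X i → X j → Overlap i j → ∀ c → ψ i ≡ just c → ψ j ≢ just c

  ColLt : Colouring → Fin n → Fin n → Set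
  ColLt ψ i j = ∃₂ λ c d → (ψ i ≡ just c) × (ψ j ≡ just d) × (c ℕ.< d)

  -- condition (i) (E = L) and (ii) (E = R) of structured colourings
  StructuredBy : (Fin n → ℚ) → (Fin n → Set) → Colouring → Set
  StructuredBy E X ψ =
    ∀ (xs : List⁺ (Fin n)) → All X (toList xs) →
    AllPairs (λ i j → ColLt ψ i j × (E i < E j)) (toList xs) →
    Σ (List (Fin n)) λ ys → (length ys ≡ length (toList xs)) × All X ys ×
      AllPairs Overlap ys ×
      All (λ j → (E (head xs) ≤ E j) × (E j ≤ E (last xs))) ys

  Structured : (Fin n → Set) → (ℕ → Set) → Colouring → Set
  Structured X C ψ =
    (∃ λ x → ∀ i → X i → x ∈ᴵ i) ×
    (∃ λ w → IsOmega X w × FinCard C w) ×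
    (∀ i → X i → ∃ λ c → (ψ i ≡ just c) × C c) ×
    ProperOn X ψ × StructuredBy L X ψ × StructuredBy R X ψ

  Pillar : ℚ → Set
  Pillar x = InOpen 0ℚ 1ℚ x × (∀ i → (x ≢ L i) × (x ≢ R i))

  -- pillars are listed in ⪯-order; `pre` is the list of pillars ≺ p
  Assigned : List ℚ → ℚ → Fin n → Set
  Assigned pre p i = (p ∈ᴵ i) × All (λ q → ¬ (q ∈ᴵ i)) pre

  AssignedSome : List ℚ → Fin n → Set
  AssignedSome ps i = ∃ λ pre → ∃₂ λ q post → (ps ≡ pre ++ q ∷ post) × Assigned pre q i

  IsFoundation : List ℚ → ℚ → ℚ → ℚ → Set
  IsFoundation pre p a b =
    InOpen a b p × (a ≡ 0ℚ ⊎ a ∈ pre) × (b ≡ 1ℚ ⊎ b ∈ pre) ×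
    All (λ q → ¬ InOpen a b q) pre

  OneEndIn : ℚ → ℚ → Fin n → Set
  OneEndIn a b i = (InOpen a b (L i) × ¬ InOpen a b (R i)) ⊎
                   (¬ InOpen a b (L i) × InOpen a b (R i))

  UsedColours : List ℚ → ℚ → ℚ → Colouring → ℕ → Set
  UsedColours pre a b ψ c = ∃ λ i → OneEndIn a b i × AssignedSome pre i × (ψ i ≡ just c)

  -- (P , ⪯ , ψ) is a pillar assignment, ⪯ being the order of the list P
  IsPillarAssignment : List ℚ → Colouring → Set₁
  IsPillarAssignment P ψ =
    Unique P × All Pillar P ×
    (∀ i c → ψ i ≡ just c → AssignedSome P i) ×
    (∀ pre p post → P ≡ pre ++ p ∷ post →
      ∃₂ λ a b → IsFoundation pre p a b ×
      Σ (ℕ → Set) λ C → ∃ λ w →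
        IsOmega (Assigned pre p) w ×
        SmallestAvoiding (UsedColours pre a b ψ) w C ×
        Structured (Assigned pre p) C ψ)

  Arch : List ℚ → ℚ → ℚ → Set
  Arch P a b = (a < b) × (a ≡ 0ℚ ⊎ a ∈ P) × (b ≡ 1ℚ ⊎ b ∈ P) ×
               All (λ q → ¬ InOpen a b q) P

  endIn : ℚ → ℚ → Fin n → Bool
  endIn x y i = (does (x <? L i) ∧ does (L i <? y)) ∨ (does (x <? R i) ∧ does (R i <? y))

  degree : Colouring → ℚ → ℚ → ℕ
  degree ψ x y = length (deduplicate ℕ._≟_
    (mapMaybe (λ i → if endIn x y i then ψ i else nothing) (allFin n)))

  χ : Colouring → ℕ
  χ ψ = length (deduplicate ℕ._≟_ (mapMaybe ψ (allFin n)))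

  Extends : List ℚ → Colouring → List ℚ → Colouring → Set
  Extends P ψ P* ψ* = (∃ λ Rest → P* ≡ P ++ Rest) ×
                      (∀ i c → ψ i ≡ just c → ψ* i ≡ just c)

{-# OPTIONS --safe #-}
-- A single new pillar q inside an arch (a , b) is handled by colouring the intervals
-- assigned to q by their height in the order ≺ (both endpoints further left): the k-th colour of
-- the palette C_q goes to height k.  All these intervals contain q, so ≺-chains are cliques; this
-- makes the colouring proper and structured, and its colours are at most d(a , b) + ω.  The
-- pillars of Q are inserted median first, which splits (a , b) into two arches receiving at most
-- half of the remaining pillars each; an interval J ⊆ K ∖ Q meets only one side at every level, so
-- it sees at most ω new colours per level over ⌈log₂ (|Q| + 1)⌉ levels.  Finally every colour
-- c of a pillar assignment has all of 1 , … , c in use (the palettes are initial segments of the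
-- unused colours and a maximum clique uses its whole palette), so c ≤ χ.
module Submission where

open import Defs
open import Data.Bool using (true; T; _∧_; if_then_else_)
open import Data.Bool.Properties using (T-≡; T-∧; T-∨)
open import Data.Empty using (⊥-elim)
open import Data.Fin using (Fin)
import Data.Fin.Properties as Fin
open import Data.List
  using (List; []; _∷_; _++_; [_]; length; map; filter; take; mapMaybe; allFin; applyUpTo; deduplicate;
         initLast; _∷ʳ′_)
import Data.List.Properties as List
open import Data.List.Extrema.Nat using (max; xs≤max; argmax-sel)
open import Data.List.Membership.Propositional using (_∈_; _∉_)
import Data.List.Membership.Propositional.Properties as ∈
open import Data.List.NonEmpty using (last) renaming (_∷_ to _∷⁺_)
open import Data.List.Relation.Binary.Permutation.Propositional using (_↭_; ↭-sym; ↭⇒↭ₛ)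
import Data.List.Relation.Binary.Permutation.Propositional.Properties as ↭
import Data.List.Relation.Binary.Permutation.Setoid.Properties as ↭ₛ
open import Data.List.Relation.Binary.Subset.Propositional using (_⊆_)
open import Data.List.Relation.Unary.All using (All; []; _∷_)
import Data.List.Relation.Unary.All as All
import Data.List.Relation.Unary.All.Properties as All
open import Data.List.Relation.Unary.AllPairs using (AllPairs; []; _∷_)
import Data.List.Relation.Unary.AllPairs as AllPairs
import Data.List.Relation.Unary.AllPairs.Properties as AllPairs
open import Data.List.Relation.Unary.Any as Any using (Any; here; there)
open import Data.List.Relation.Unary.Linked.Properties using (Linked⇒AllPairs)
open import Data.List.Relation.Unary.Unique.Propositional using (Unique)
import Data.List.Relation.Unary.Unique.DecPropositional.Properties as Unique
import Data.List.Relation.Unary.Unique.Propositional.Properties as Unique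
open import Data.Maybe using (Maybe; just; nothing; fromMaybe)
open import Data.Maybe.Properties using (just-injective)
open import Data.Nat using (ℕ; zero; suc; _+_; _*_; _∸_; _⊔_; _≤_; _<_; z≤n; s≤s; ⌈_/2⌉; ⌊_/2⌋)
import Data.Nat.Properties as ℕ
open import Data.Nat.Induction using (<-rec)
open import Data.Nat.Logarithm using (⌈log₂_⌉)
import Data.Nat.Logarithm as Log
open import Data.Product using (Σ; ∃; ∃₂; _×_; _,_; proj₁; proj₂; swap)
import Data.Product as Product
open import Data.Product.Function.NonDependent.Propositional using (_×-⇔_)
open import Data.Rational using (ℚ; 0ℚ; 1ℚ)
  renaming (_<_ to _<ℚ_; _≤_ to _≤ℚ_; _<?_ to _<ℚ?_)
import Data.Rational.Properties as ℚ
open import Data.Sum using (_⊎_; inj₁; inj₂; [_,_]′)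
import Data.Sum as Sum
open import Data.Sum.Function.Propositional using (_⊎-⇔_)
open import Data.Unit using (⊤; tt)
open import Function using (_∘_; const)
open import Function.Bundles using (_⇔_; mk⇔; Equivalence)
import Function.Properties.Equivalence as ⇔
open import Relation.Binary.Definitions using (tri<; tri≈; tri>)
open import Relation.Binary.PropositionalEquality
  using (_≡_; _≢_; refl; sym; trans; cong; subst; subst₂; setoid; module ≡-Reasoning)
open import Relation.Nullary using (¬_; Dec; yes; no; does; ¬?; _×-dec_; contradiction)
open import Relation.Unary using (Decidable)

open import Data.List.Membership.DecPropositional ℕ._≟_ using (_∈?_)
open import Data.List.Sort ℚ.≤-decTotalOrder using (sort; sort-↭; sort-↗)

private
  variable
    A B : Set

T-does : (d : Dec A) → T (does d) ⇔ A
T-does (yes a) = mk⇔ (const a) (const tt)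
T-does (no ¬a) = mk⇔ (λ ()) ¬a

∈-++-∷⁻ : {x z : A} (us vs : List A) → z ∈ us ++ x ∷ vs → z ≢ x → z ∈ us ++ vs
∈-++-∷⁻ []       vs (here z≡x) z≢x = contradiction z≡x z≢x
∈-++-∷⁻ []       vs (there z∈)  _   = z∈
∈-++-∷⁻ (u ∷ us) vs (here z≡u) _   = here z≡u
∈-++-∷⁻ (u ∷ us) vs (there z∈)  z≢x = there (∈-++-∷⁻ us vs z∈ z≢x)

Unique-⊆⇒length≤ : {xs ys : List A} → Unique xs → xs ⊆ ys → length xs ≤ length ys
Unique-⊆⇒length≤ {xs = []}     _              _     = z≤n
Unique-⊆⇒length≤ {xs = x ∷ xs} (x∉xs ∷ xs!) xs⊆ys
  with us , vs , refl ← ∈.∈-∃++ (xs⊆ys (here refl)) = begin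
    suc (length xs)             ≤⟨ s≤s (Unique-⊆⇒length≤ xs! xs⊆us++vs) ⟩
    suc (length (us ++ vs))     ≡⟨ cong suc (List.length-++ us) ⟩
    suc (length us + length vs) ≡⟨ ℕ.+-suc (length us) (length vs) ⟨
    length us + length (x ∷ vs) ≡⟨ List.length-++ us ⟨
    length (us ++ x ∷ vs)       ∎
  where
  open ℕ.≤-Reasoning
  xs⊆us++vs : xs ⊆ us ++ vs
  xs⊆us++vs z∈xs = ∈-++-∷⁻ us vs (xs⊆ys (there z∈xs)) (λ { refl → All.lookup x∉xs z∈xs refl })

Unique-⊆-length≤⇒⊇ : {xs ys : List ℕ} → Unique xs → xs ⊆ ys → length ys ≤ length xs → ys ⊆ xs
Unique-⊆-length≤⇒⊇ {xs} {ys} xs! xs⊆ys ys≤xs {c} c∈ys with c ∈? xs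
... | yes c∈xs = c∈xs
... | no  c∉xs = contradiction ys≤xs (ℕ.<⇒≱ (begin-strict
    length xs                 ≤⟨ Unique-⊆⇒length≤ xs! xs⊆others ⟩
    length (filter ≢c? ys)    <⟨ List.filter-notAll ≢c? ys (∈-witness c∈ys) ⟩
    length ys                 ∎))
  where
  open ℕ.≤-Reasoning
  ≢c? : (d : ℕ) → Dec (d ≢ c)
  ≢c? d = ¬? (d ℕ.≟ c)
  xs⊆others : xs ⊆ filter ≢c? ys
  xs⊆others {d} d∈xs = ∈.∈-filter⁺ ≢c? (xs⊆ys d∈xs) (λ { refl → c∉xs d∈xs })
  ∈-witness : c ∈ ys → Any (λ d → ¬ (d ≢ c)) ys
  ∈-witness = Any.map (λ { refl ne → ne refl })

length-filter-≤ : {P Q : A → Set} (P? : Decidable P) (Q? : Decidable Q) → (∀ {x} → P x → Q x) →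
                  ∀ xs → length (filter P? xs) ≤ length (filter Q? xs)
length-filter-≤ P? Q? P⇒Q [] = z≤n
length-filter-≤ P? Q? P⇒Q (x ∷ xs) with P? x | Q? x
... | yes _  | yes _  = s≤s (length-filter-≤ P? Q? P⇒Q xs)
... | yes px | no ¬qx = contradiction (P⇒Q px) ¬qx
... | no _   | yes _  = ℕ.m≤n⇒m≤1+n (length-filter-≤ P? Q? P⇒Q xs)
... | no _   | no _   = length-filter-≤ P? Q? P⇒Q xs

length-filter-< : {P Q : A → Set} (P? : Decidable P) (Q? : Decidable Q) → (∀ {x} → P x → Q x) →
                  ∀ {y} xs → y ∈ xs → Q y → ¬ P y → length (filter P? xs) < length (filter Q? xs)
length-filter-< P? Q? P⇒Q (x ∷ xs) (here refl) qy ¬py with P? x | Q? x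
... | yes py | _      = contradiction py ¬py
... | no _   | yes _  = s≤s (length-filter-≤ P? Q? P⇒Q xs)
... | no _   | no ¬qy = contradiction qy ¬qy
length-filter-< P? Q? P⇒Q (x ∷ xs) (there y∈) qy ¬py with P? x | Q? x
... | yes _  | yes _  = s≤s (length-filter-< P? Q? P⇒Q xs y∈ qy ¬py)
... | yes px | no ¬qx = contradiction (P⇒Q px) ¬qx
... | no _   | yes _  = ℕ.m≤n⇒m≤1+n (length-filter-< P? Q? P⇒Q xs y∈ qy ¬py)
... | no _   | no _   = length-filter-< P? Q? P⇒Q xs y∈ qy ¬py

AllPairs-mapWith : {P : A → Set} {R R′ : A → A → Set} → (∀ {x y} → P x → P y → R x y → R′ x y) →
                   ∀ {xs} → All P xs → AllPairs R xs → AllPairs R′ xs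
AllPairs-mapWith f []         []         = []
AllPairs-mapWith f (px ∷ pxs) (rx ∷ rxs) =
  All.zipWith (λ (py , r) → f px py r) (pxs , rx) ∷ AllPairs-mapWith f pxs rxs

AllPairs-split : {R : A → A → Set} (l : List A) {mid : A} {r : List A} → AllPairs R (l ++ mid ∷ r) →
                 AllPairs R l × All (λ z → R z mid) l × All (R mid) r × AllPairs R r
AllPairs-split []      (mid< ∷ r-pairs) = [] , [] , mid< , r-pairs
AllPairs-split (z ∷ l) (z< ∷ pairs) with l-pairs , l<mid , mid<r , r-pairs ← AllPairs-split l pairs =
  All.++⁻ˡ l z< ∷ l-pairs , All.head (All.++⁻ʳ l z<) ∷ l<mid , mid<r , r-pairs

split-at : ∀ k (xs : List A) → k < length xs → ∃ λ l → ∃₂ λ mid r → xs ≡ l ++ mid ∷ r × length l ≡ k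
split-at zero    (x ∷ xs) _       = [] , x , xs , refl , refl
split-at (suc k) (x ∷ xs) (s≤s k<) with l , mid , r , refl , refl ← split-at k xs k< =
  x ∷ l , mid , r , refl , refl

split-∷ʳ : ∀ (P pre post : List A) p q → P ++ [ q ] ≡ pre ++ p ∷ post →
           (pre ≡ P × p ≡ q × post ≡ []) ⊎ ∃ λ post′ → post ≡ post′ ++ [ q ] × P ≡ pre ++ p ∷ post′
split-∷ʳ P pre post p q eq with initLast post
... | [] with refl , refl ← List.∷ʳ-injective pre P (sym eq) = inj₁ (refl , refl , refl)
... | post′ ∷ʳ′ r with refl , refl ← List.∷ʳ-injective P (pre ++ p ∷ post′)
                                      (trans eq (sym (List.++-assoc pre (p ∷ post′) [ r ]))) =
  inj₂ (post′ , refl , refl)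

last-∷ : (x y : A) (ys : List A) → last (x ∷⁺ y ∷ ys) ≡ last (y ∷⁺ ys)
last-∷ x y ys with initLast ys
... | []     = refl
... | _ ∷ʳ′ _ = refl

∈-take⁻ : ∀ w {xs : List A} {c} → c ∈ take w xs → c ∈ xs
∈-take⁻ (suc w) {_ ∷ _} (here c≡x) = here c≡x
∈-take⁻ (suc w) {_ ∷ _} (there c∈) = there (∈-take⁻ w c∈)

∈-mapMaybe⁺ : (f : A → Maybe B) {x : A} {c : B} (xs : List A) → x ∈ xs → f x ≡ just c →
              c ∈ mapMaybe f xs
∈-mapMaybe⁺ f (y ∷ xs) (here refl) fx≡c with f y
∈-mapMaybe⁺ f (y ∷ xs) (here refl) refl | just _ = here refl
∈-mapMaybe⁺ f (y ∷ xs) (there x∈)  fx≡c with f y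
... | nothing = ∈-mapMaybe⁺ f xs x∈ fx≡c
... | just _  = there (∈-mapMaybe⁺ f xs x∈ fx≡c)

∈-mapMaybe⁻ : (f : A → Maybe B) {c : B} (xs : List A) → c ∈ mapMaybe f xs →
              ∃ λ x → x ∈ xs × f x ≡ just c
∈-mapMaybe⁻ f (y ∷ xs) c∈ with f y in fy≡
∈-mapMaybe⁻ f (y ∷ xs) c∈          | nothing with x , x∈ , fx≡ ← ∈-mapMaybe⁻ f xs c∈ = x , there x∈ , fx≡
∈-mapMaybe⁻ f (y ∷ xs) (here refl) | just _ = y , here refl , fy≡
∈-mapMaybe⁻ f (y ∷ xs) (there c∈)  | just _ with x , x∈ , fx≡ ← ∈-mapMaybe⁻ f xs c∈ = x , there x∈ , fx≡

dedup : List ℕ → List ℕ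
dedup = deduplicate ℕ._≟_

length-dedup-≤ : (xs ys extra : List ℕ) → (∀ {c} → c ∈ xs → c ∈ ys ⊎ c ∈ extra) →
                 length (dedup xs) ≤ length (dedup ys) + length extra
length-dedup-≤ xs ys extra covered = subst (_ ≤_) (List.length-++ (dedup ys))
  (Unique-⊆⇒length≤ (Unique.deduplicate-! ℕ._≟_ xs)
    (λ c∈ → [ ∈.∈-++⁺ˡ ∘ ∈.∈-deduplicate⁺ ℕ._≟_ , ∈.∈-++⁺ʳ (dedup ys) ]′
              (covered (∈.∈-deduplicate⁻ ℕ._≟_ xs c∈))))

oneTo : ℕ → List ℕ
oneTo = applyUpTo suc

∈-oneTo⁺ : ∀ {M c} → 1 ≤ c → c ≤ M → c ∈ oneTo M
∈-oneTo⁺ {c = suc c} _ c<M = ∈.∈-applyUpTo⁺ suc c<M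

∈-oneTo⁻ : ∀ {M c} → c ∈ oneTo M → 1 ≤ c × c ≤ M
∈-oneTo⁻ c∈ with _ , c<M , refl ← ∈.∈-applyUpTo⁻ suc c∈ = s≤s z≤n , c<M

Unique-oneTo : ∀ M → Unique (oneTo M)
Unique-oneTo M = Unique.applyUpTo⁺₁ suc M (λ i<j _ → ℕ.<⇒≢ (s≤s i<j))

length≤-of-bounded : ∀ M {xs : List ℕ} → Unique xs → (∀ {c} → c ∈ xs → 1 ≤ c × c ≤ M) →
                     length xs ≤ M
length≤-of-bounded M xs! bounded = subst (_ ≤_) (List.length-applyUpTo suc M)
  (Unique-⊆⇒length≤ xs! (λ c∈ → ∈-oneTo⁺ (proj₁ (bounded c∈)) (proj₂ (bounded c∈))))

≤length-of-covering : ∀ c {xs : List ℕ} → (∀ {d} → 1 ≤ d → d ≤ c → d ∈ xs) → c ≤ length xs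
≤length-of-covering c covering = subst (_≤ _) (List.length-applyUpTo suc c)
  (Unique-⊆⇒length≤ (Unique-oneTo c) (λ d∈ → covering (proj₁ (∈-oneTo⁻ d∈)) (proj₂ (∈-oneTo⁻ d∈))))

Sorted< : List ℕ → Set
Sorted< = AllPairs _<_

Sorted<⇒Unique : ∀ {xs} → Sorted< xs → Unique xs
Sorted<⇒Unique = AllPairs.map ℕ.<⇒≢

∈-take-downClosed : ∀ w {xs c c′} → Sorted< xs → c ∈ take w xs → c′ ∈ xs → c′ < c → c′ ∈ take w xs
∈-take-downClosed (suc w) (_ ∷ _)     (here refl) (here refl) c′<c = contradiction c′<c (ℕ.<-irrefl refl)
∈-take-downClosed (suc w) (x< ∷ _)    (here refl) (there c′∈) c′<c =
  contradiction (All.lookup x< c′∈) (ℕ.<-asym c′<c)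
∈-take-downClosed (suc w) (_ ∷ _)     (there _)   (here refl) _    = here refl
∈-take-downClosed (suc w) (_ ∷ sorted) (there c∈)  (there c′∈) c′<c =
  there (∈-take-downClosed w sorted c∈ c′∈ c′<c)

nth : List ℕ → ℕ → ℕ
nth []       _       = 0
nth (x ∷ xs) zero    = x
nth (x ∷ xs) (suc k) = nth xs k

nth-∈ : ∀ xs {k} → k < length xs → nth xs k ∈ xs
nth-∈ (x ∷ xs) {zero}  _         = here refl
nth-∈ (x ∷ xs) {suc k} (s≤s k<) = there (nth-∈ xs k<)

nth-mono : ∀ {xs i j} → Sorted< xs → i < j → j < length xs → nth xs i < nth xs j
nth-mono {x ∷ xs} {zero}  {suc j} (x< ∷ _)      _         (s≤s j<) = All.lookup x< (nth-∈ xs j<)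
nth-mono {x ∷ xs} {suc i} {suc j} (_ ∷ sorted) (s≤s i<j) (s≤s j<) = nth-mono sorted i<j j<

nth-reflects-< : ∀ {xs i j} → Sorted< xs → i < length xs → j < length xs → nth xs i < nth xs j → i < j
nth-reflects-< {i = i} {j} sorted i< j< nth< with ℕ.<-cmp i j
... | tri< i<j _ _ = i<j
... | tri≈ _ refl _ = contradiction nth< (ℕ.<-irrefl refl)
... | tri> _ _ j<i = contradiction (nth-mono sorted j<i i<) (ℕ.<-asym nth<)

FinCard-list : ∀ {xs} → Unique xs → FinCard (_∈ xs) (length xs)
FinCard-list {xs} xs! = record
  { elems = xs ; len = refl ; uniq = xs! ; sound = λ _ x∈ → x∈ ; complete = λ _ x∈ → x∈ }

SmallestAvoiding-cong : ∀ {U U′ w C} → (∀ c → U c ⇔ U′ c) → SmallestAvoiding U w C → SmallestAvoiding U′ w C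
SmallestAvoiding-cong U⇔U′ (card , avoids , downClosed) =
  card , (λ c c∈C → Product.map₂ (_∘ Equivalence.from (U⇔U′ c)) (avoids c c∈C)) ,
  (λ c c′ c∈C 1≤c′ c′<c c′∉U′ → downClosed c c′ c∈C 1≤c′ c′<c (c′∉U′ ∘ Equivalence.to (U⇔U′ c′)))

-- The colour set C_p of the paper, in increasing order, for U the colours already used on F_p.
module Palette (U : List ℕ) (w : ℕ) where

  ∉U? : Decidable (_∉ U)
  ∉U? c = ¬? (c ∈? U)

  limit : ℕ
  limit = max 0 U + w

  candidates : List ℕ
  candidates = filter ∉U? (oneTo limit)

  palette : List ℕ
  palette = take w candidates

  candidates-sorted : Sorted< candidates
  candidates-sorted = AllPairs.filter⁺ ∉U? (AllPairs.applyUpTo⁺₁ suc limit (λ i<j _ → s≤s i<j))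

  palette-sorted : Sorted< palette
  palette-sorted = AllPairs.take⁺ w candidates-sorted

  ∈-candidates⁻ : ∀ {c} → c ∈ candidates → (1 ≤ c × c ≤ limit) × c ∉ U
  ∈-candidates⁻ c∈ = Product.map₁ ∈-oneTo⁻ (∈.∈-filter⁻ ∉U? c∈)

  -- The integers max U + 1 , … , max U + w are candidates.
  w≤length-candidates : w ≤ length candidates
  w≤length-candidates = subst (_≤ length candidates) (List.length-applyUpTo above w)
    (Unique-⊆⇒length≤ (Unique.applyUpTo⁺₁ above w (λ i<j _ → ℕ.<⇒≢ (s≤s (ℕ.+-monoʳ-< _ i<j))))
      λ c∈ → let _ , i<w , c≡ = ∈.∈-applyUpTo⁻ above c∈ in
        subst (_∈ candidates) (sym c≡) (∈.∈-filter⁺ ∉U?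
          (∈-oneTo⁺ (s≤s z≤n) (ℕ.+-monoʳ-< _ i<w))
          (λ above∈U → ℕ.<⇒≱ (s≤s (ℕ.m≤m+n _ _)) (All.lookup (xs≤max 0 U) above∈U))))
    where
    above : ℕ → ℕ
    above i = suc (max 0 U + i)

  length-palette : length palette ≡ w
  length-palette = trans (List.length-take w candidates) (ℕ.m≤n⇒m⊓n≡m w≤length-candidates)

  ∈-palette⁻ : ∀ {c} → c ∈ palette → 1 ≤ c × c ∉ U
  ∈-palette⁻ c∈ = let (1≤c , _) , c∉U = ∈-candidates⁻ (∈-take⁻ w c∈) in 1≤c , c∉U

  palette-downClosed : ∀ {c c′} → c ∈ palette → 1 ≤ c′ → c′ < c → c′ ∉ U → c′ ∈ palette
  palette-downClosed c∈ 1≤c′ c′<c c′∉U =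
    let (_ , c≤limit) , _ = ∈-candidates⁻ (∈-take⁻ w c∈) in
    ∈-take-downClosed w candidates-sorted c∈
      (∈.∈-filter⁺ ∉U? (∈-oneTo⁺ 1≤c′ (ℕ.<⇒≤ (ℕ.<-≤-trans c′<c c≤limit))) c′∉U) c′<c

  palette-bounded : ∀ {c} → c ∈ palette → c ≤ length (dedup U) + w
  palette-bounded {c} c∈ = begin
    c                                 ≤⟨ ≤length-of-covering c covered ⟩
    length (dedup U ++ palette)       ≡⟨ List.length-++ (dedup U) ⟩
    length (dedup U) + length palette ≡⟨ cong (length (dedup U) +_) length-palette ⟩
    length (dedup U) + w              ∎
    where
    open ℕ.≤-Reasoning
    covered : ∀ {d} → 1 ≤ d → d ≤ c → d ∈ dedup U ++ palette
    covered {d} 1≤d d≤c with d ∈? U | d ℕ.≟ c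
    ... | yes d∈U | _        = ∈.∈-++⁺ˡ (∈.∈-deduplicate⁺ ℕ._≟_ d∈U)
    ... | no  _   | yes refl = ∈.∈-++⁺ʳ (dedup U) c∈
    ... | no  d∉U | no d≢c   = ∈.∈-++⁺ʳ (dedup U) (palette-downClosed c∈ 1≤d (ℕ.≤∧≢⇒< d≤c d≢c) d∉U)

InOpen? : ∀ a b x → Dec (InOpen a b x)
InOpen? a b x with a <ℚ? x | x <ℚ? b
... | yes a<x | yes x<b = yes (a<x , x<b)
... | no  a≮x | _       = no (a≮x ∘ proj₁)
... | _       | no  x≮b = no (x≮b ∘ proj₂)

InOpen-mono : ∀ {a b a′ b′ x} → a ≤ℚ a′ → b′ ≤ℚ b → InOpen a′ b′ x → InOpen a b x
InOpen-mono a≤a′ b′≤b (a′<x , x<b′) = ℚ.≤-<-trans a≤a′ a′<x , ℚ.<-≤-trans x<b′ b′≤b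

<ℚ-irrefl : ∀ {x} → ¬ (x <ℚ x)
<ℚ-irrefl = ℚ.<-irrefl refl

≤∧≢⇒<ℚ : ∀ {p q} → p ≤ℚ q → p ≢ q → p <ℚ q
≤∧≢⇒<ℚ {p} {q} p≤q p≢q with ℚ.<-cmp p q
... | tri< p<q _ _ = p<q
... | tri≈ _ p≡q _ = contradiction p≡q p≢q
... | tri> _ _ q<p = contradiction (ℚ.≤-antisym p≤q (ℚ.<⇒≤ q<p)) p≢q

module Geometry (S : IntervalSystem) where
  open IntervalSystem S

  infix 4 _≺_
  _≺_ : Fin n → Fin n → Set
  i ≺ j = L i <ℚ L j × R i <ℚ R j

  ≺-trans : ∀ {i j k} → i ≺ j → j ≺ k → i ≺ k
  ≺-trans (Li<Lj , Ri<Rj) (Lj<Lk , Rj<Rk) = ℚ.<-trans Li<Lj Lj<Lk , ℚ.<-trans Ri<Rj Rj<Rk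

  _≺?_ : ∀ i j → Dec (i ≺ j)
  i ≺? j with L i <ℚ? L j | R i <ℚ? R j
  ... | yes p | yes q = yes (p , q)
  ... | no ¬p | _     = no (¬p ∘ proj₁)
  ... | _     | no ¬q = no (¬q ∘ proj₂)

  _∈ᴵ?_ : ∀ x i → Dec (_∈ᴵ_ S x i)
  x ∈ᴵ? i = InOpen? (L i) (R i) x

  L-injective : ∀ {i j} → L i ≡ L j → i ≡ j
  L-injective {i} {j} Li≡Lj with i Fin.≟ j
  ... | yes i≡j = i≡j
  ... | no  i≢j = contradiction Li≡Lj (proj₁ (noSharedEndpoint i j i≢j))

  R-injective : ∀ {i j} → R i ≡ R j → i ≡ j
  R-injective {i} {j} Ri≡Rj with i Fin.≟ j
  ... | yes i≡j = i≡j
  ... | no  i≢j = contradiction Ri≡Rj (proj₂ (proj₂ (noSharedEndpoint i j i≢j)))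

  ⊆ᴵ-by-endpoints : ∀ i j → L j ≤ℚ L i → R i ≤ℚ R j → _⊆ᴵ_ S i j
  ⊆ᴵ-by-endpoints i j Lj≤Li Ri≤Rj x = InOpen-mono Lj≤Li Ri≤Rj

  Overlap-sym : ∀ {i j} → Overlap S i j → Overlap S j i
  Overlap-sym (i≢j , (x , x∈i , x∈j) , i⊈j , j⊈i) = i≢j ∘ sym , (x , x∈j , x∈i) , j⊈i , i⊈j

  Overlap⇒≺⊎≻ : ∀ {i j} → Overlap S i j → i ≺ j ⊎ j ≺ i
  Overlap⇒≺⊎≻ {i} {j} (i≢j , _ , i⊈j , j⊈i) with ℚ.<-cmp (L i) (L j) | ℚ.<-cmp (R i) (R j)
  ... | tri≈ _ Li≡Lj _ | _              = contradiction (L-injective Li≡Lj) i≢j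
  ... | _              | tri≈ _ Ri≡Rj _ = contradiction (R-injective Ri≡Rj) i≢j
  ... | tri< Li<Lj _ _ | tri< Ri<Rj _ _ = inj₁ (Li<Lj , Ri<Rj)
  ... | tri> _ _ Lj<Li | tri> _ _ Rj<Ri = inj₂ (Lj<Li , Rj<Ri)
  ... | tri< Li<Lj _ _ | tri> _ _ Rj<Ri = contradiction (⊆ᴵ-by-endpoints j i (ℚ.<⇒≤ Li<Lj) (ℚ.<⇒≤ Rj<Ri)) j⊈i
  ... | tri> _ _ Lj<Li | tri< Ri<Rj _ _ = contradiction (⊆ᴵ-by-endpoints i j (ℚ.<⇒≤ Lj<Li) (ℚ.<⇒≤ Ri<Rj)) i⊈j

  ≺⇒Overlap : ∀ {i j} x → _∈ᴵ_ S x i → _∈ᴵ_ S x j → i ≺ j → Overlap S i j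
  ≺⇒Overlap {i} {j} x x∈i@(Li<x , x<Ri) x∈j@(Lj<x , x<Rj) (Li<Lj , Ri<Rj) =
    (λ { refl → <ℚ-irrefl Li<Lj }) , (x , x∈i , x∈j) , i⊈j , j⊈i
    where
    i⊈j : ¬ _⊆ᴵ_ S i j
    i⊈j i⊆j with z , Li<z , z<Lj ← ℚ.<-dense Li<Lj =
      <ℚ-irrefl (ℚ.<-trans z<Lj (proj₁ (i⊆j z (Li<z , ℚ.<-trans z<Lj (ℚ.<-trans Lj<x x<Ri)))))
    j⊈i : ¬ _⊆ᴵ_ S j i
    j⊈i j⊆i with z , Ri<z , z<Rj ← ℚ.<-dense Ri<Rj =
      <ℚ-irrefl (ℚ.<-trans Ri<z (proj₂ (j⊆i z (ℚ.<-trans Lj<x (ℚ.<-trans x<Ri Ri<z) , z<Rj))))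

-- Heights

module Height (S : IntervalSystem) (X : Fin (IntervalSystem.n S) → Set) (X? : Decidable X) where
  open IntervalSystem S
  open Geometry S

  rank : Fin n → ℕ
  rank B = length (filter (λ j → L j <ℚ? L B) (allFin n))

  rank-mono : ∀ {A B} → A ≺ B → rank A < rank B
  rank-mono {A} {B} (LA<LB , _) = length-filter-< (λ j → L j <ℚ? L A) (λ j → L j <ℚ? L B)
    (λ Lj<LA → ℚ.<-trans Lj<LA LA<LB) (allFin n) (∈.∈-allFin A) LA<LB <ℚ-irrefl

  below : Fin n → List (Fin n)
  below B = filter (λ A → X? A ×-dec A ≺? B) (allFin n)

  ∈-below⁻ : ∀ {A B} → A ∈ below B → X A × A ≺ B
  ∈-below⁻ {B = B} = proj₂ ∘ ∈.∈-filter⁻ (λ A → X? A ×-dec A ≺? B) {xs = allFin n}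

  -- The fuel f only has to exceed the rank (heightWithin-stable).
  heightWithin : ℕ → Fin n → ℕ
  heightWithin zero    B = 0
  heightWithin (suc f) B = suc (max 0 (map (heightWithin f) (below B)))

  heightWithin-stable : ∀ f f′ B → rank B < f → rank B < f′ → heightWithin f B ≡ heightWithin f′ B
  heightWithin-stable (suc f) (suc f′) B (s≤s rB≤f) (s≤s rB≤f′) =
    cong (suc ∘ max 0) (List.map-cong-local (All.tabulate agree))
    where
    agree : ∀ {A} → A ∈ below B → heightWithin f A ≡ heightWithin f′ A
    agree A∈ = let rA<rB = rank-mono (proj₂ (∈-below⁻ A∈)) in
      heightWithin-stable f f′ _ (ℕ.<-≤-trans rA<rB rB≤f) (ℕ.<-≤-trans rA<rB rB≤f′)

  height : Fin n → ℕ
  height B = heightWithin (suc (rank B)) B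

  height-unfold : ∀ B → height B ≡ suc (max 0 (map height (below B)))
  height-unfold B = cong (suc ∘ max 0) (List.map-cong-local (All.tabulate agree))
    where
    agree : ∀ {A} → A ∈ below B → heightWithin (rank B) A ≡ height A
    agree A∈ = heightWithin-stable _ _ _ (rank-mono (proj₂ (∈-below⁻ A∈))) ℕ.≤-refl

  height-mono : ∀ {A B} → X A → A ≺ B → height A < height B
  height-mono {A} {B} xA A≺B rewrite height-unfold B =
    s≤s (All.lookup (xs≤max 0 _) (∈.∈-map⁺ height (∈.∈-filter⁺ _ (∈.∈-allFin A) (xA , A≺B))))

  height-predecessor : ∀ B → 2 ≤ height B → ∃ λ B′ → X B′ × B′ ≺ B × suc (height B′) ≡ height B
  height-predecessor B 2≤hB with argmax-sel (λ h → h) 0 (map height (below B))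
  ... | inj₁ max≡0 = contradiction (subst (2 ≤_) (trans (height-unfold B) (cong suc max≡0)) 2≤hB)
                                   λ { (s≤s ()) }
  ... | inj₂ max∈ with B′ , B′∈ , max≡ ← ∈.∈-map⁻ height max∈ =
    B′ , proj₁ (∈-below⁻ B′∈) , proj₂ (∈-below⁻ B′∈) , sym (trans (height-unfold B) (cong suc max≡))

  Descending : ℕ → (Fin n → Set) → Set
  Descending m Bound = Σ (List (Fin n)) λ ys →
    length ys ≡ m × All X ys × AllPairs (λ C D → D ≺ C) ys × All Bound ys

  descending-below : ∀ k B → height B ≡ suc k → Descending k (_≺ B)
  descending-below zero    B _ = [] , refl , [] , [] , []
  descending-below (suc k) B hB≡2+k
    with B′ , xB′ , B′≺B , hB′+1≡hB ← height-predecessor B (subst (2 ≤_) (sym hB≡2+k) (s≤s (s≤s z≤n)))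
    with ys , len , xys , desc , ys≺B′ ← descending-below k B′ (ℕ.suc-injective (trans hB′+1≡hB hB≡2+k)) =
    B′ ∷ ys , cong suc len , xB′ ∷ xys , ys≺B′ ∷ desc , B′≺B ∷ All.map (λ C≺B′ → ≺-trans C≺B′ B′≺B) ys≺B′

  maxHeight : ℕ
  maxHeight = max 0 (map height (filter X? (allFin n)))

  height≤maxHeight : ∀ {B} → X B → height B ≤ maxHeight
  height≤maxHeight {B} xB =
    All.lookup (xs≤max 0 _) (∈.∈-map⁺ height (∈.∈-filter⁺ X? (∈.∈-allFin B) xB))

  maxHeight-attained : maxHeight ≡ 0 ⊎ ∃ λ B → X B × height B ≡ maxHeight
  maxHeight-attained with argmax-sel (λ h → h) 0 (map height (filter X? (allFin n)))
  ... | inj₁ max≡0 = inj₁ max≡0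
  ... | inj₂ max∈ with B , B∈ , max≡ ← ∈.∈-map⁻ height max∈ =
    inj₂ (B , proj₂ (∈.∈-filter⁻ X? {xs = allFin n} B∈) , sym max≡)

-- E , F = L , R gives condition (i) of structuredness, E , F = R , L condition (ii).
module HeightStructured (S : IntervalSystem) (X : Fin (IntervalSystem.n S) → Set) (X? : Decidable X)
  (E F : Fin (IntervalSystem.n S) → ℚ)
  (≺⇒ : ∀ {A B} → Geometry._≺_ S A B → E A <ℚ E B × F A <ℚ F B)
  (⇒≺ : ∀ {A B} → E A <ℚ E B → F A <ℚ F B → Geometry._≺_ S A B)
  (E-injective : ∀ {A B} → E A ≡ E B → A ≡ B)
  (F-injective : ∀ {A B} → F A ≡ F B → A ≡ B) where
  open IntervalSystem S
  open Geometry S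
  open Height S X X?

  E-mono : ∀ {A B} → A ≺ B → E A ≤ℚ E B
  E-mono = ℚ.<⇒≤ ∘ proj₁ ∘ ≺⇒

  module _ (x : ℚ) where
    ChainBelow : Fin n → ℕ → Set
    ChainBelow B zero    = ⊤
    ChainBelow B (suc m) = Σ (Fin n) λ D → X D × D ≺ B × x ≤ℚ E D × ChainBelow D m

    ChainTo : Fin n → ℕ → Set
    ChainTo B zero    = ⊤
    ChainTo B (suc m) = Σ (Fin n) λ D → X D × (D ≺ B ⊎ D ≡ B) × x ≤ℚ E D × ChainBelow D m

    ChainTo⇒ChainBelow : ∀ {A B} m → ChainTo A m → A ≺ B → ChainBelow B m
    ChainTo⇒ChainBelow zero    _                                   _   = tt
    ChainTo⇒ChainBelow (suc m) (D , xD , inj₁ D≺A , x≤ED , chain) A≺B =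
      D , xD , ≺-trans D≺A A≺B , x≤ED , chain
    ChainTo⇒ChainBelow (suc m) (D , xD , inj₂ refl , x≤ED , chain) A≺B = D , xD , A≺B , x≤ED , chain

    chain-extend : ∀ m A B → X A → X B → x ≤ℚ E A → E A <ℚ E B → height A < height B →
                   ChainTo A m → ChainTo B (suc m)
    chain-transfer : ∀ m A B → X A → X B → x ≤ℚ E A → E A ≤ℚ E B → height A ≤ height B →
                     ChainTo A m → ChainTo B m
    chain-transfer-below : ∀ m A B → X A → X B → x ≤ℚ E A → E A ≤ℚ E B → height A ≤ height B →
                           ChainBelow A m → ChainTo B (suc m)

    -- If A ⊀ B then B is nested in A; the predecessor B′ of B in height then lies E-above A
    -- (otherwise B′ ≺ A, contradicting height B′ ≥ height A), and A's chain moves to B′.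
    chain-extend m A B xA xB x≤EA EA<EB hA<hB chain =
      B , xB , inj₂ refl , ℚ.≤-trans x≤EA (ℚ.<⇒≤ EA<EB) , below-B
      where
      below-B : ChainBelow B m
      below-B with A ≺? B
      ... | yes A≺B = ChainTo⇒ChainBelow m chain A≺B
      ... | no  A⊀B with ℚ.<-cmp (F A) (F B)
      ...   | tri< FA<FB _ _ = contradiction (⇒≺ EA<EB FA<FB) A⊀B
      ...   | tri≈ _ FA≡FB _ = contradiction (subst (λ k → E k <ℚ E B) (F-injective FA≡FB) EA<EB) <ℚ-irrefl
      ...   | tri> _ _ FB<FA
        with B′ , xB′ , B′≺B , hB′+1≡hB ← height-predecessor B (ℕ.≤-trans (s≤s (s≤s z≤n)) hA<hB)
        with ℚ.<-cmp (E B′) (E A)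
      ...     | tri< EB′<EA _ _ =
                  contradiction (height-mono xB′ (⇒≺ EB′<EA (ℚ.<-trans (proj₂ (≺⇒ B′≺B)) FB<FA)))
                    (ℕ.≤⇒≯ (ℕ.≤-pred (subst (suc (height A) ≤_) (sym hB′+1≡hB) hA<hB)))
      ...     | tri≈ _ EB′≡EA _ = contradiction (subst (_≺ B) (E-injective EB′≡EA) B′≺B) A⊀B
      ...     | tri> _ _ EA<EB′ = ChainTo⇒ChainBelow m
                  (chain-transfer m A B′ xA xB′ x≤EA (ℚ.<⇒≤ EA<EB′)
                    (ℕ.≤-pred (subst (suc (height A) ≤_) (sym hB′+1≡hB) hA<hB)) chain) B′≺B

    chain-transfer zero    A B _  _  _    _     _     _ = tt
    chain-transfer (suc m) A B xA xB x≤EA EA≤EB hA≤hB (D , _ , inj₂ refl , _ , chain) =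
      chain-transfer-below m A B xA xB x≤EA EA≤EB hA≤hB chain
    chain-transfer (suc m) A B xA xB x≤EA EA≤EB hA≤hB (D , xD , inj₁ D≺A , x≤ED , chain) =
      chain-transfer-below m D B xD xB x≤ED (ℚ.≤-trans (E-mono D≺A) EA≤EB)
        (ℕ.≤-trans (ℕ.<⇒≤ (height-mono xD D≺A)) hA≤hB) chain

    chain-transfer-below zero    A B xA xB x≤EA EA≤EB hA≤hB _ = B , xB , inj₂ refl , ℚ.≤-trans x≤EA EA≤EB , tt
    chain-transfer-below (suc m) A B xA xB x≤EA EA≤EB hA≤hB (A′ , xA′ , A′≺A , x≤EA′ , chain) =
      chain-extend (suc m) A′ B xA′ xB x≤EA′ (ℚ.<-≤-trans (proj₁ (≺⇒ A′≺A)) EA≤EB)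
        (ℕ.<-≤-trans (height-mono xA′ A′≺A) hA≤hB) (A′ , xA′ , inj₂ refl , x≤EA′ , chain)

    ChainBelow⇒Descending : ∀ B m → ChainBelow B m → Descending m (λ D → x ≤ℚ E D × D ≺ B)
    ChainBelow⇒Descending B zero    _ = [] , refl , [] , [] , []
    ChainBelow⇒Descending B (suc m) (D , xD , D≺B , x≤ED , chain)
      with ys , len , xys , desc , bounds ← ChainBelow⇒Descending D m chain =
      D ∷ ys , cong suc len , xD ∷ xys , All.map proj₂ bounds ∷ desc ,
      (x≤ED , D≺B) ∷ All.map (λ (x≤EC , C≺D) → x≤EC , ≺-trans C≺D D≺B) bounds

    ChainTo⇒Descending : ∀ B m → ChainTo B m → Descending m (λ D → x ≤ℚ E D × E D ≤ℚ E B)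
    ChainTo⇒Descending B zero    _ = [] , refl , [] , [] , []
    ChainTo⇒Descending B (suc m) (D , xD , D≼B , x≤ED , chain)
      with ys , len , xys , desc , bounds ← ChainBelow⇒Descending D m chain =
      D ∷ ys , cong suc len , xD ∷ xys , All.map proj₂ bounds ∷ desc ,
      (x≤ED , ED≤EB) ∷ All.map (λ (x≤EC , C≺D) → x≤EC , ℚ.≤-trans (E-mono C≺D) ED≤EB) bounds
      where
      ED≤EB : E D ≤ℚ E B
      ED≤EB = [ E-mono , (λ { refl → ℚ.≤-refl }) ]′ D≼B

    chain-along : ∀ m A zs → All X (A ∷ zs) →
                  AllPairs (λ C D → height C < height D × E C <ℚ E D) (A ∷ zs) →
                  x ≤ℚ E A → ChainTo A m → ChainTo (last (A ∷⁺ zs)) (m + length zs)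
    chain-along m A []       _                 _                      _    chain =
      subst (ChainTo A) (sym (ℕ.+-identityʳ m)) chain
    chain-along m A (z ∷ zs) (xA ∷ xz ∷ xzs) (((hA<hz , EA<Ez) ∷ _) ∷ incr) x≤EA chain =
      subst₂ ChainTo (sym (last-∷ A z zs)) (sym (ℕ.+-suc m (length zs)))
        (chain-along (suc m) z zs (xz ∷ xzs) incr (ℚ.≤-trans x≤EA (ℚ.<⇒≤ EA<Ez))
          (chain-extend m A z xA xz x≤EA EA<Ez hA<hz chain))

  structured-by-height : ∀ {ψ} q → (∀ {i} → X i → _∈ᴵ_ S q i) →
                         (∀ {i j} → X i → X j → ColLt S ψ i j → height i < height j) → StructuredBy S E X ψ
  structured-by-height q q∈ height< (A ∷⁺ zs) xs increasing
    with ys , len , xys , desc , bounds ← ChainTo⇒Descending (E A) (last (A ∷⁺ zs)) (suc (length zs))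
           (chain-along (E A) 1 A zs xs
              (AllPairs-mapWith (λ xi xj (lt , E<) → height< xi xj lt , E<) xs increasing)
              ℚ.≤-refl (A , All.head xs , inj₂ refl , ℚ.≤-refl , tt)) =
    ys , len , xys ,
    AllPairs-mapWith (λ xC xD D≺C → Overlap-sym (≺⇒Overlap q (q∈ xD) (q∈ xC) D≺C)) xys desc , bounds

module Degrees (S : IntervalSystem) where
  open IntervalSystem S

  -- A record, so that x , y and i can be inferred from a proof.
  record EndsIn (x y : ℚ) (i : Fin n) : Set where
    constructor mkEndsIn
    field endIn≡true : endIn S x y i ≡ true

  EndsIn⇔ : ∀ {x y i} → EndsIn x y i ⇔ (InOpen x y (L i) ⊎ InOpen x y (R i))
  EndsIn⇔ {x} {y} {i} = ⇔.trans (mk⇔ EndsIn.endIn≡true mkEndsIn) (⇔.trans (⇔.sym T-≡) (⇔.trans T-∨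
    (both (x <ℚ? L i) (L i <ℚ? y) ⊎-⇔ both (x <ℚ? R i) (R i <ℚ? y))))
    where
    both : ∀ {P Q} (p? : Dec P) (q? : Dec Q) → T (does p? ∧ does q?) ⇔ (P × Q)
    both p? q? = ⇔.trans T-∧ (T-does p? ×-⇔ T-does q?)

  EndsIn-widen : ∀ {x y x′ y′ i} → x′ ≤ℚ x → y ≤ℚ y′ → EndsIn x y i → EndsIn x′ y′ i
  EndsIn-widen x′≤x y≤y′ =
    Equivalence.from EndsIn⇔ ∘ Sum.map (InOpen-mono x′≤x y≤y′) (InOpen-mono x′≤x y≤y′) ∘
    Equivalence.to EndsIn⇔

  ¬EndsIn-leftOf : ∀ {x y c i} → y ≤ℚ c → c ≤ℚ L i → ¬ EndsIn x y i
  ¬EndsIn-leftOf {i = i} y≤c c≤L ends with Equivalence.to EndsIn⇔ ends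
  ... | inj₁ (_ , L<y) = <ℚ-irrefl (ℚ.<-≤-trans L<y (ℚ.≤-trans y≤c c≤L))
  ... | inj₂ (_ , R<y) = <ℚ-irrefl (ℚ.<-trans (ℚ.<-≤-trans R<y (ℚ.≤-trans y≤c c≤L)) (L<R i))

  ¬EndsIn-rightOf : ∀ {x y c i} → c ≤ℚ x → R i ≤ℚ c → ¬ EndsIn x y i
  ¬EndsIn-rightOf {i = i} c≤x R≤c ends with Equivalence.to EndsIn⇔ ends
  ... | inj₁ (x<L , _) = <ℚ-irrefl (ℚ.<-≤-trans (ℚ.<-trans x<L (L<R i)) (ℚ.≤-trans R≤c c≤x))
  ... | inj₂ (x<R , _) = <ℚ-irrefl (ℚ.<-≤-trans x<R (ℚ.≤-trans R≤c c≤x))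

  OneEndIn? : ∀ a b i → Dec (OneEndIn S a b i)
  OneEndIn? a b i with InOpen? a b (L i) | InOpen? a b (R i)
  ... | yes l | no ¬r = yes (inj₁ (l , ¬r))
  ... | no ¬l | yes r = yes (inj₂ (¬l , r))
  ... | yes l | yes r = no [ (λ (_ , ¬r) → ¬r r) , (λ (¬l , _) → ¬l l) ]′
  ... | no ¬l | no ¬r = no [ (λ (l , _) → ¬l l) , (λ (_ , r) → ¬r r) ]′

  OneEndIn⇒EndsIn : ∀ {a b i} → OneEndIn S a b i → EndsIn a b i
  OneEndIn⇒EndsIn = Equivalence.from EndsIn⇔ ∘ Sum.map proj₁ proj₂

  Recolouring : (Fin n → Set) → Colouring S → Colouring S → (Fin n → ℕ → Set) → Set
  Recolouring Y ψ ψ′ New = ∀ i c → Y i → ψ′ i ≡ just c → ψ i ≡ just c ⊎ New i c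

  recolouring-trans : ∀ {Y ψ₁ ψ₂ ψ₃ N₁ N₂} → Recolouring Y ψ₁ ψ₂ N₁ → Recolouring Y ψ₂ ψ₃ N₂ →
                      Recolouring Y ψ₁ ψ₃ (λ i c → N₁ i c ⊎ N₂ i c)
  recolouring-trans r₁₂ r₂₃ i c yi ψ₃i≡c with r₂₃ i c yi ψ₃i≡c
  ... | inj₁ ψ₂i≡c = Sum.map₂ inj₁ (r₁₂ i c yi ψ₂i≡c)
  ... | inj₂ new   = inj₂ (inj₂ new)

  recolouring-weaken : ∀ {Y ψ ψ′ N N′} → (∀ i c → Y i → N i c → N′ i c) →
                       Recolouring Y ψ ψ′ N → Recolouring Y ψ ψ′ N′
  recolouring-weaken N⇒N′ r i c yi ψ′i≡c = Sum.map₂ (N⇒N′ i c yi) (r i c yi ψ′i≡c)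

  recolouring-restrict : ∀ {Y ψ ψ′ N} → Recolouring (λ _ → ⊤) ψ ψ′ N → Recolouring Y ψ ψ′ N
  recolouring-restrict r i c _ = r i c tt

  endColour : Colouring S → ℚ → ℚ → Fin n → Maybe ℕ
  endColour ψ x y i = if endIn S x y i then ψ i else nothing

  endColours : Colouring S → ℚ → ℚ → List ℕ
  endColours ψ x y = mapMaybe (endColour ψ x y) (allFin n)

  ∈-endColours⁺ : ∀ {ψ x y i c} → EndsIn x y i → ψ i ≡ just c → c ∈ endColours ψ x y
  ∈-endColours⁺ {ψ} {x} {y} {i} (mkEndsIn endIn≡true) ψi≡c =
    ∈-mapMaybe⁺ (endColour ψ x y) (allFin n) (∈.∈-allFin i)
      (trans (cong (λ b → if b then ψ i else nothing) endIn≡true) ψi≡c)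

  ∈-endColours⁻ : ∀ {ψ x y c} → c ∈ endColours ψ x y → ∃ λ i → EndsIn x y i × ψ i ≡ just c
  ∈-endColours⁻ {ψ} {x} {y} c∈
    with i , _ , sel≡c ← ∈-mapMaybe⁻ (endColour ψ x y) (allFin n) c∈
    with endIn S x y i in endIn≡true
  ... | true = i , mkEndsIn endIn≡true , sel≡c

  degree-≤ : ∀ {ψ ψ′ x y x′ y′} (extra : List ℕ) → x′ ≤ℚ x → y ≤ℚ y′ →
             Recolouring (EndsIn x y) ψ ψ′ (λ _ c → c ∈ extra) →
             degree S ψ′ x y ≤ degree S ψ x′ y′ + length extra
  degree-≤ {ψ} {ψ′} {x} {y} {x′} {y′} extra x′≤x y≤y′ recol =
    length-dedup-≤ (endColours ψ′ x y) (endColours ψ x′ y′) extra covered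
    where
    covered : ∀ {c} → c ∈ endColours ψ′ x y → c ∈ endColours ψ x′ y′ ⊎ c ∈ extra
    covered c∈ with i , ends , ψ′i≡c ← ∈-endColours⁻ {ψ′} {x} {y} c∈ =
      Sum.map₁ (∈-endColours⁺ (EndsIn-widen x′≤x y≤y′ ends)) (recol i _ ends ψ′i≡c)

module Assignments (S : IntervalSystem) where
  open IntervalSystem S

  AssignedSome-++ : ∀ {P i} R → AssignedSome S P i → AssignedSome S (P ++ R) i
  AssignedSome-++ R (pre , p , post , refl , assigned) =
    pre , p , post ++ R , List.++-assoc pre (p ∷ post) R , assigned

  PillarCondition : List ℚ → ℚ → Colouring S → Set₁
  PillarCondition pre p ψ = ∃₂ λ a b → IsFoundation S pre p a b ×
    Σ (ℕ → Set) λ C → ∃ λ w → IsOmega S (Assigned S pre p) w ×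
      SmallestAvoiding (UsedColours S pre a b ψ) w C × Structured S (Assigned S pre p) C ψ

  Structured-cong : ∀ {Y C ψ ψ′} → (∀ i → Y i → ψ′ i ≡ ψ i) → Structured S Y C ψ → Structured S Y C ψ′
  Structured-cong {Y} {C} {ψ} {ψ′} agree (point , size , coloured , proper , byL , byR) =
    point , size , coloured′ , proper′ , by byL , by byR
    where
    coloured′ : ∀ i → Y i → ∃ λ c → ψ′ i ≡ just c × C c
    coloured′ i yi with c , ψi≡c , c∈C ← coloured i yi = c , trans (agree i yi) ψi≡c , c∈C
    proper′ : ProperOn S Y ψ′
    proper′ i j yi yj o c ψ′i≡c ψ′j≡c =
      proper i j yi yj o c (trans (sym (agree i yi)) ψ′i≡c) (trans (sym (agree j yj)) ψ′j≡c)
    by : ∀ {E} → StructuredBy S E Y ψ → StructuredBy S E Y ψ′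
    by structured xs ys increasing = structured xs ys (AllPairs-mapWith
      (λ {i} {j} yi yj ((c , d , ψ′i≡c , ψ′j≡d , c<d) , E<) →
        (c , d , trans (sym (agree i yi)) ψ′i≡c , trans (sym (agree j yj)) ψ′j≡d , c<d) , E<)
      ys increasing)

  UsedColours-cong : ∀ {pre a b ψ ψ′} → (∀ i → AssignedSome S pre i → ψ′ i ≡ ψ i) →
                     ∀ c → UsedColours S pre a b ψ c ⇔ UsedColours S pre a b ψ′ c
  UsedColours-cong agree c = mk⇔
    (λ (i , oneEnd , assigned , ψi≡c) → i , oneEnd , assigned , trans (agree i assigned) ψi≡c)
    (λ (i , oneEnd , assigned , ψ′i≡c) → i , oneEnd , assigned , trans (sym (agree i assigned)) ψ′i≡c)

  clique-uses-all : ∀ {Y C ψ w} → Clique S Y w → FinCard C w → (∀ i → Y i → ∃ λ c → ψ i ≡ just c × C c) →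
                    ProperOn S Y ψ → ∀ {d} → C d → ∃ λ j → ψ j ≡ just d
  clique-uses-all {Y} {C} {ψ} {w} (ys , length-ys , yys , overlapping) card coloured proper {d} d∈C =
    used (∈.∈-map⁻ colourOf (elems⊆colours (FinCard.complete card d d∈C)))
    where
    open FinCard card using (elems; complete)
    colourOf : Fin n → ℕ
    colourOf i = fromMaybe 0 (ψ i)
    colourOf-≡ : ∀ {i} → Y i → ψ i ≡ just (colourOf i)
    colourOf-≡ {i} yi with c , ψi≡c , _ ← coloured i yi rewrite ψi≡c = refl
    colours-differ : ∀ {i j} → Y i → Y j → Overlap S i j → colourOf i ≢ colourOf j
    colours-differ {i} {j} yi yj o same =
      proper i j yi yj o (colourOf i) (colourOf-≡ yi) (trans (colourOf-≡ yj) (cong just (sym same)))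
    colour∈C : ∀ {i} → Y i → C (colourOf i)
    colour∈C {i} yi with c , ψi≡c , c∈C ← coloured i yi =
      subst C (just-injective (trans (sym ψi≡c) (colourOf-≡ yi))) c∈C
    colours⊆elems : map colourOf ys ⊆ elems
    colours⊆elems c∈ with i , i∈ , refl ← ∈.∈-map⁻ colourOf c∈ = complete _ (colour∈C (All.lookup yys i∈))
    elems⊆colours : elems ⊆ map colourOf ys
    elems⊆colours = Unique-⊆-length≤⇒⊇ (AllPairs.map⁺ (AllPairs-mapWith colours-differ yys overlapping))
      colours⊆elems
      (ℕ.≤-reflexive (trans (FinCard.len card) (sym (trans (List.length-map colourOf ys) length-ys))))
    used : (∃ λ j → j ∈ ys × d ≡ colourOf j) → ∃ λ j → ψ j ≡ just d
    used (j , j∈ , d≡) = j , trans (colourOf-≡ (All.lookup yys j∈)) (cong just (sym d≡))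

  colours-used-below : ∀ {P ψ} → IsPillarAssignment S P ψ → ∀ {i c} → ψ i ≡ just c →
                       1 ≤ c × ∀ {d} → 1 ≤ d → d ≤ c → ∃ λ j → ψ j ≡ just d
  colours-used-below {P} {ψ} (_ , _ , coloured⇒assigned , conditions) {i} {c} ψi≡c
    with pre , p , post , P≡ , assigned ← coloured⇒assigned i c ψi≡c
    with _ , _ , _ , C , _ , _ , (_ , avoids , downClosed) , (_ , (_ , omega , card) , coloured , proper , _)
           ← conditions pre p post P≡
    with c′ , ψi≡c′ , c′∈C ← coloured i assigned
    with refl ← just-injective (trans (sym ψi≡c) ψi≡c′) =
    proj₁ (avoids c c′∈C) , below
    where
    below : ∀ {d} → 1 ≤ d → d ≤ c → ∃ λ j → ψ j ≡ just d
    below {d} 1≤d d≤c with d ℕ.≟ c | d ∈? mapMaybe ψ (allFin n)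
    ... | yes refl | _     = i , ψi≡c
    ... | no _     | yes d∈ = let j , _ , ψj≡d = ∈-mapMaybe⁻ ψ (allFin n) d∈ in j , ψj≡d
    ... | no d≢c   | no d∉ = clique-uses-all (proj₁ omega) card coloured proper
      (downClosed c d c′∈C 1≤d (ℕ.≤∧≢⇒< d≤c d≢c)
        λ (j , _ , _ , ψj≡d) → d∉ (∈-mapMaybe⁺ ψ (allFin n) (∈.∈-allFin j) ψj≡d))

  colour≤χ : ∀ {P ψ} → IsPillarAssignment S P ψ → ∀ {i c} → ψ i ≡ just c → 1 ≤ c × c ≤ χ S ψ
  colour≤χ {ψ = ψ} valid {c = c} ψi≡c with 1≤c , below ← colours-used-below valid ψi≡c =
    1≤c , ≤length-of-covering c λ 1≤d d≤c → let j , ψj≡d = below 1≤d d≤c in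
      ∈.∈-deduplicate⁺ ℕ._≟_ (∈-mapMaybe⁺ ψ (allFin n) (∈.∈-allFin j) ψj≡d)

-- Inserting one pillar

module OnePillar (S : IntervalSystem) (ω : ℕ) (ω-spec : IsOmega S (λ _ → ⊤) ω)
  (P : List ℚ) (ψ : Colouring S) (valid : IsPillarAssignment S P ψ)
  (a b : ℚ) (arch : Arch S P a b) (q : ℚ) (q∈ab : InOpen a b q) (q-pillar : Pillar S q) where
  open IntervalSystem S
  open Geometry S
  open Degrees S
  open Assignments S

  coloured⇒assigned : ∀ i c → ψ i ≡ just c → AssignedSome S P i
  coloured⇒assigned = proj₁ (proj₂ (proj₂ valid))

  P-outside : All (λ z → ¬ InOpen a b z) P
  P-outside = proj₂ (proj₂ (proj₂ arch))

  X : Fin n → Set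
  X = Assigned S P q

  X? : Decidable X
  X? i = (q ∈ᴵ? i) ×-dec All.all? (λ z → ¬? (z ∈ᴵ? i)) P

  open Height S X X?

  ¬X-at : ∀ {z i} → z ∈ P → _∈ᴵ_ S z i → ¬ X i
  ¬X-at z∈P z∈i (_ , P-outside-i) = All.lookup P-outside-i z∈P z∈i

  AssignedSome⇒¬X : ∀ {pre i} → pre ⊆ P → AssignedSome S pre i → ¬ X i
  AssignedSome⇒¬X pre⊆P (pre′ , p , _ , refl , p∈i , _) = ¬X-at (pre⊆P (∈.∈-++⁺ʳ pre′ (here refl))) p∈i

  coloured⇒¬X : ∀ {i c} → ψ i ≡ just c → ¬ X i
  coloured⇒¬X {i} {c} ψi≡c = AssignedSome⇒¬X (λ z∈ → z∈) (coloured⇒assigned i c ψi≡c)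

  X-inside : ∀ {i} → X i → a ≤ℚ L i × R i ≤ℚ b
  X-inside {i} xi@((Li<q , q<Ri) , _) = left (proj₁ (proj₂ arch)) , right (proj₁ (proj₂ (proj₂ arch)))
    where
    left : a ≡ 0ℚ ⊎ a ∈ P → a ≤ℚ L i
    left (inj₁ refl) = 0≤L i
    left (inj₂ a∈P)  = ℚ.≮⇒≥ λ Li<a → ¬X-at a∈P (Li<a , ℚ.<-trans (proj₁ q∈ab) q<Ri) xi
    right : b ≡ 1ℚ ⊎ b ∈ P → R i ≤ℚ b
    right (inj₁ refl) = R≤1 i
    right (inj₂ b∈P)  = ℚ.≮⇒≥ λ b<Ri → ¬X-at b∈P (ℚ.<-trans Li<q (proj₂ q∈ab) , b<Ri) xi

  X-clique : Clique S X maxHeight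
  X-clique with maxHeight-attained
  ... | inj₁ max≡0 = [] , sym max≡0 , [] , []
  ... | inj₂ (B , xB , hB≡max) with ys , len , xys , desc , ys≺B ← descending-below _ B refl =
    B ∷ ys , trans (cong suc len) hB≡max , xB ∷ xys ,
    AllPairs-mapWith ≺⇒Overlap-X (xB ∷ xys) (ys≺B ∷ desc)
    where
    ≺⇒Overlap-X : ∀ {C D} → X C → X D → D ≺ C → Overlap S C D
    ≺⇒Overlap-X xC xD D≺C = Overlap-sym (≺⇒Overlap q (proj₁ xD) (proj₁ xC) D≺C)

  height-injective-on-overlap : ∀ {A B} → X A → X B → Overlap S A B → height A ≢ height B
  height-injective-on-overlap xA xB o with Overlap⇒≺⊎≻ o
  ... | inj₁ A≺B = ℕ.<⇒≢ (height-mono xA A≺B)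
  ... | inj₂ B≺A = ℕ.<⇒≢ (height-mono xB B≺A) ∘ sym

  X-omega : IsOmega S X maxHeight
  X-omega = X-clique , bounded
    where
    bounded : ∀ k → Clique S X k → k ≤ maxHeight
    bounded k (ys , len , xys , overlapping) = subst (_≤ maxHeight) (trans (List.length-map height ys) len)
      (length≤-of-bounded maxHeight
        (AllPairs.map⁺ (AllPairs-mapWith height-injective-on-overlap xys overlapping))
        λ h∈ → let y , y∈ , h≡ = ∈.∈-map⁻ height h∈ in
          subst (λ h → 1 ≤ h × h ≤ maxHeight) (sym h≡) (s≤s z≤n , height≤maxHeight (All.lookup xys y∈)))

  maxHeight≤ω : maxHeight ≤ ω
  maxHeight≤ω = let ys , len , _ , overlapping = X-clique in
    proj₂ ω-spec maxHeight (ys , len , All.universal _ ys , overlapping)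

  oneEndColour : Fin n → Maybe ℕ
  oneEndColour i with OneEndIn? a b i
  ... | yes _ = ψ i
  ... | no  _ = nothing

  foundationColours : List ℕ
  foundationColours = mapMaybe oneEndColour (allFin n)

  ∈-foundationColours⁺ : ∀ {i c} → OneEndIn S a b i → ψ i ≡ just c → c ∈ foundationColours
  ∈-foundationColours⁺ {i} oneEnd ψi≡c = ∈-mapMaybe⁺ oneEndColour (allFin n) (∈.∈-allFin i) selected
    where
    selected : oneEndColour i ≡ just _
    selected with OneEndIn? a b i
    ... | yes _       = ψi≡c
    ... | no ¬oneEnd = contradiction oneEnd ¬oneEnd

  ∈-foundationColours⁻ : ∀ {c} → c ∈ foundationColours → ∃ λ i → OneEndIn S a b i × ψ i ≡ just c
  ∈-foundationColours⁻ c∈ with i , _ , selected ← ∈-mapMaybe⁻ oneEndColour (allFin n) c∈ =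
    i , unselect selected
    where
    unselect : ∀ {i c} → oneEndColour i ≡ just c → OneEndIn S a b i × ψ i ≡ just c
    unselect {i} selected with OneEndIn? a b i
    unselect ψi≡c | yes oneEnd = oneEnd , ψi≡c
    unselect ()   | no _

  open Palette foundationColours maxHeight public using (palette)
  open Palette foundationColours maxHeight hiding (palette)

  height-index : ∀ {i} → X i → height i ∸ 1 < length palette
  height-index {i} xi = subst (height i ∸ 1 <_) (sym length-palette) (height≤maxHeight xi)

  colour : Fin n → ℕ
  colour i = nth palette (height i ∸ 1)

  colour∈palette : ∀ {i} → X i → colour i ∈ palette
  colour∈palette xi = nth-∈ palette (height-index xi)

  ψ′ : Colouring S
  ψ′ i with X? i
  ... | yes _ = just (colour i)
  ... | no  _ = ψ i

  ψ′-X : ∀ {i} → X i → ψ′ i ≡ just (colour i)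
  ψ′-X {i} xi with X? i
  ... | yes _ = refl
  ... | no ¬xi = contradiction xi ¬xi

  ψ′-¬X : ∀ {i} → ¬ X i → ψ′ i ≡ ψ i
  ψ′-¬X {i} ¬xi with X? i
  ... | yes xi = contradiction xi ¬xi
  ... | no _   = refl

  colour-of : ∀ {i c} → X i → ψ′ i ≡ just c → colour i ≡ c
  colour-of xi ψ′i≡c = just-injective (trans (sym (ψ′-X xi)) ψ′i≡c)

  ψ′-extends : ∀ i c → ψ i ≡ just c → ψ′ i ≡ just c
  ψ′-extends i c ψi≡c = trans (ψ′-¬X (coloured⇒¬X ψi≡c)) ψi≡c

  ψ′-recolouring : Recolouring (λ _ → ⊤) ψ ψ′ (λ i c → (a ≤ℚ L i × R i ≤ℚ b) × c ∈ palette)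
  ψ′-recolouring i c _ ψ′i≡c with X? i
  ... | yes xi = inj₂ (X-inside xi , subst (_∈ palette) (just-injective ψ′i≡c) (colour∈palette xi))
  ... | no  _  = inj₁ ψ′i≡c

  palette-bounds : ∀ {c} → c ∈ palette → 1 ≤ c × c ≤ degree S ψ a b + ω
  palette-bounds c∈ =
    proj₁ (∈-palette⁻ c∈) , ℕ.≤-trans (palette-bounded c∈) (ℕ.+-mono-≤ foundation≤degree maxHeight≤ω)
    where
    foundation≤degree : length (dedup foundationColours) ≤ degree S ψ a b
    foundation≤degree = subst (length (dedup foundationColours) ≤_) (ℕ.+-identityʳ _)
      (length-dedup-≤ foundationColours (endColours ψ a b) [] λ c∈ →
        let i , oneEnd , ψi≡c = ∈-foundationColours⁻ c∈ in
        inj₁ (∈-endColours⁺ (OneEndIn⇒EndsIn oneEnd) ψi≡c))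

  length-palette≤ω : length palette ≤ ω
  length-palette≤ω = subst (_≤ ω) (sym length-palette) maxHeight≤ω

  ColLt⇒height< : ∀ {i j} → X i → X j → ColLt S ψ′ i j → height i < height j
  ColLt⇒height< xi xj (c , d , ψ′i≡c , ψ′j≡d , c<d) = s≤s (nth-reflects-< palette-sorted
    (height-index xi) (height-index xj)
    (subst₂ _<_ (sym (colour-of xi ψ′i≡c)) (sym (colour-of xj ψ′j≡d)) c<d))

  ψ′-proper : ProperOn S X ψ′
  ψ′-proper i j xi xj o c ψ′i≡c ψ′j≡c = colours-differ (Overlap⇒≺⊎≻ o)
    (trans (colour-of xi ψ′i≡c) (sym (colour-of xj ψ′j≡c)))
    where
    colours-differ : i ≺ j ⊎ j ≺ i → colour i ≢ colour j
    colours-differ (inj₁ i≺j) =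
      ℕ.<⇒≢ (nth-mono palette-sorted (ℕ.≤-pred (height-mono xi i≺j)) (height-index xj))
    colours-differ (inj₂ j≺i) =
      ℕ.<⇒≢ (nth-mono palette-sorted (ℕ.≤-pred (height-mono xj j≺i)) (height-index xi)) ∘ sym

  palette-card : FinCard (_∈ palette) maxHeight
  palette-card = subst (FinCard (_∈ palette)) length-palette (FinCard-list (Sorted<⇒Unique palette-sorted))

  X-structured : Structured S X (_∈ palette) ψ′
  X-structured =
    (q , λ _ → proj₁) ,
    (maxHeight , X-omega , palette-card) ,
    (λ i xi → colour i , ψ′-X xi , colour∈palette xi) ,
    ψ′-proper ,
    HeightStructured.structured-by-height S X X? L R (λ i≺j → i≺j) _,_ L-injective R-injective
      q proj₁ ColLt⇒height< ,
    HeightStructured.structured-by-height S X X? R L swap (λ Ri<Rj Li<Lj → Li<Lj , Ri<Rj)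
      R-injective L-injective q proj₁ ColLt⇒height<

  used⇔foundation : ∀ c → UsedColours S P a b ψ′ c ⇔ c ∈ foundationColours
  used⇔foundation c = mk⇔
    (λ (i , oneEnd , assigned , ψ′i≡c) →
      ∈-foundationColours⁺ oneEnd (trans (sym (ψ′-¬X (AssignedSome⇒¬X (λ z∈ → z∈) assigned))) ψ′i≡c))
    (λ c∈ → let i , oneEnd , ψi≡c = ∈-foundationColours⁻ c∈ in
      i , oneEnd , coloured⇒assigned i c ψi≡c , ψ′-extends i c ψi≡c)

  palette-avoiding : SmallestAvoiding (UsedColours S P a b ψ′) maxHeight (_∈ palette)
  palette-avoiding =
    palette-card ,
    (λ c c∈ → proj₁ (∈-palette⁻ c∈) , proj₂ (∈-palette⁻ c∈) ∘ Equivalence.to (used⇔foundation c)) ,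
    (λ c c′ c∈ 1≤c′ c′<c c′∉used →
      palette-downClosed c∈ 1≤c′ c′<c (c′∉used ∘ Equivalence.from (used⇔foundation c′)))

  ψ′-valid : IsPillarAssignment S (P ++ [ q ]) ψ′
  ψ′-valid = AllPairs.++⁺ P! ([] ∷ []) (All.map (λ z∉ab → (λ { refl → z∉ab q∈ab }) ∷ []) P-outside) ,
             All.++⁺ P-pillars (q-pillar ∷ []) , coloured⇒assigned′ , conditions
    where
    P! : Unique P
    P! = proj₁ valid
    P-pillars : All (Pillar S) P
    P-pillars = proj₁ (proj₂ valid)

    coloured⇒assigned′ : ∀ i c → ψ′ i ≡ just c → AssignedSome S (P ++ [ q ]) i
    coloured⇒assigned′ i c ψ′i≡c with X? i
    ... | yes xi = P , q , [] , refl , xi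
    ... | no  _  = AssignedSome-++ [ q ] (coloured⇒assigned i c ψ′i≡c)

    conditions : ∀ pre p post → P ++ [ q ] ≡ pre ++ p ∷ post → PillarCondition pre p ψ′
    conditions pre p post eq with split-∷ʳ P pre post p q eq
    ... | inj₁ (refl , refl , refl) =
      a , b , (q∈ab , proj₁ (proj₂ arch) , proj₁ (proj₂ (proj₂ arch)) , P-outside) ,
      (_∈ palette) , maxHeight , X-omega , palette-avoiding , X-structured
    ... | inj₂ (post′ , refl , P≡) with a′ , b′ , foundation , C , w , omega , avoiding , structured ←
                                           proj₂ (proj₂ (proj₂ valid)) pre p post′ P≡ =
      a′ , b′ , foundation , C , w , omega ,
      SmallestAvoiding-cong (UsedColours-cong (λ i → ψ′-¬X ∘ AssignedSome⇒¬X pre⊆P)) avoiding ,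
      Structured-cong (λ i → ψ′-¬X ∘ ¬X-at p∈P ∘ proj₁) structured
      where
      pre⊆P : pre ⊆ P
      pre⊆P z∈ = subst (_ ∈_) (sym P≡) (∈.∈-++⁺ˡ z∈)
      p∈P : p ∈ P
      p∈P = subst (_ ∈_) (sym P≡) (∈.∈-++⁺ʳ pre (here refl))

-- Balanced insertion

depth : ℕ → ℕ
depth m = ⌈log₂ (m + 1)⌉

depth-mono : ∀ {m m′} → m ≤ m′ → depth m ≤ depth m′
depth-mono = Log.⌈log₂⌉-mono-≤ ∘ ℕ.+-monoˡ-≤ 1

depth-suc-⌈/2⌉ : ∀ m → suc (depth ⌈ m /2⌉) ≡ depth (suc m)
depth-suc-⌈/2⌉ m = begin
  suc ⌈log₂ (⌈ m /2⌉ + 1) ⌉        ≡⟨ cong (suc ∘ ⌈log₂_⌉) (ℕ.+-comm ⌈ m /2⌉ 1) ⟩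
  suc ⌈log₂ ⌈ 2 + m /2⌉ ⌉          ≡⟨ cong suc (Log.⌈log₂⌈n/2⌉⌉≡⌈log₂n⌉∸1 (2 + m)) ⟩
  suc (⌈log₂ (2 + m) ⌉ ∸ 1)        ≡⟨ ℕ.m+[n∸m]≡n 1≤log₂[2+m] ⟩
  ⌈log₂ (2 + m) ⌉                  ≡⟨ cong ⌈log₂_⌉ (ℕ.+-comm 1 (suc m)) ⟩
  ⌈log₂ (suc m + 1) ⌉              ∎
  where
  open ≡-Reasoning
  1≤log₂[2+m] : 1 ≤ ⌈log₂ (2 + m) ⌉
  1≤log₂[2+m] = subst (_≤ ⌈log₂ (2 + m) ⌉) (Log.⌈log₂2^n⌉≡n 1) (Log.⌈log₂⌉-mono-≤ {2} {2 + m} (s≤s (s≤s z≤n)))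

depth-suc-⌊/2⌋ : ∀ m → suc (depth ⌊ m /2⌋) ≤ depth (suc m)
depth-suc-⌊/2⌋ m = ℕ.≤-trans (s≤s (depth-mono (ℕ.⌊n/2⌋≤⌈n/2⌉ m))) (ℕ.≤-reflexive (depth-suc-⌈/2⌉ m))

ω+ω*t≤ω*T : ∀ ω {t T} → suc t ≤ T → ω + ω * t ≤ ω * T
ω+ω*t≤ω*T ω {t} {T} t<T = subst (_≤ ω * T) (ℕ.*-suc ω t) (ℕ.*-monoʳ-≤ ω t<T)

sort-strict : ∀ {Q} → Unique Q → AllPairs _<ℚ_ (sort Q)
sort-strict {Q} Q! = AllPairs.zipWith (λ (p≤q , p≢q) → ≤∧≢⇒<ℚ p≤q p≢q)
  (Linked⇒AllPairs ℚ.≤-trans (sort-↗ Q) ,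
   ↭ₛ.Unique-resp-↭ (setoid ℚ) (↭⇒↭ₛ (↭-sym (sort-↭ Q))) Q!)

module Insertion (S : IntervalSystem) (ω : ℕ) (ω-spec : IsOmega S (λ _ → ⊤) ω) where
  open IntervalSystem S
  open Degrees S

  record FreshColour (ψ : Colouring S) (a b : ℚ) (T : ℕ) (i : Fin n) (c : ℕ) : Set where
    constructor mkFresh
    field
      within   : a ≤ℚ L i × R i ≤ℚ b
      positive : 1 ≤ c
      bounded  : c ≤ degree S ψ a b + ω * T

  InsidePillars : ℚ → ℚ → List ℚ → Set
  InsidePillars a b = All (λ z → InOpen a b z × Pillar S z)

  FewNewColours : ℕ → ℚ → ℚ → Colouring S → Colouring S → Set
  FewNewColours k x y ψ ψ′ =
    Σ (List ℕ) λ new → length new ≤ k × Recolouring (EndsIn x y) ψ ψ′ (λ _ c → c ∈ new)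

  record Inserted (P : List ℚ) (ψ : Colouring S) (a b : ℚ) (Qs : List ℚ) : Set₁ where
    field
      added      : List ℚ
      ψ*         : Colouring S
      ψ*-valid   : IsPillarAssignment S (P ++ added) ψ*
      added⊆Qs   : added ⊆ Qs
      Qs⊆added   : Qs ⊆ added
      ψ*-extends : ∀ i c → ψ i ≡ just c → ψ* i ≡ just c
      ψ*-fresh   : Recolouring (λ _ → ⊤) ψ ψ* (FreshColour ψ a b (depth (length Qs)))
      ψ*-local   : ∀ x y → InsideMinus a b Qs x y → FewNewColours (ω * depth (length Qs)) x y ψ ψ*

  insert-nothing : ∀ {P ψ} → IsPillarAssignment S P ψ → ∀ a b → Inserted P ψ a b []
  insert-nothing {P} {ψ} valid a b = record
    { added = [] ; ψ* = ψ
    ; ψ*-valid = subst (λ P′ → IsPillarAssignment S P′ ψ) (sym (List.++-identityʳ P)) valid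
    ; added⊆Qs = λ () ; Qs⊆added = λ () ; ψ*-extends = λ _ _ ψi≡c → ψi≡c ; ψ*-fresh = λ _ _ _ → inj₁
    ; ψ*-local = λ _ _ _ → [] , z≤n , λ _ _ _ → inj₁ }

  fresh-bound : ∀ {c d d′ t T} → c ≤ d′ + ω * t → d′ ≤ d + ω → suc t ≤ T → c ≤ d + ω * T
  fresh-bound {c} {d} {d′} {t} {T} c≤ d′≤ t<T = begin
    c               ≤⟨ c≤ ⟩
    d′ + ω * t      ≤⟨ ℕ.+-monoˡ-≤ (ω * t) d′≤ ⟩
    d + ω + ω * t   ≡⟨ ℕ.+-assoc d ω (ω * t) ⟩
    d + (ω + ω * t) ≤⟨ ℕ.+-monoʳ-≤ d (ω+ω*t≤ω*T ω t<T) ⟩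
    d + ω * T       ∎
    where open ℕ.≤-Reasoning

  -- A colour new to an interval J ⊆ (a , b) ∖ Qs comes from the palette of mid or from the
  -- one half whose arch contains J (local-l , local-r).
  module Combine {P ψ a b} (valid : IsPillarAssignment S P ψ) (arch : Arch S P a b)
    (l : List ℚ) (mid : ℚ) (r : List ℚ)
    (sorted : AllPairs _<ℚ_ (l ++ mid ∷ r)) (inside : InsidePillars a b (l ++ mid ∷ r))
    (insert-l : ∀ {P′ ψ′ a′ b′} → IsPillarAssignment S P′ ψ′ → Arch S P′ a′ b′ →
                AllPairs _<ℚ_ l → InsidePillars a′ b′ l → Inserted P′ ψ′ a′ b′ l)
    (insert-r : ∀ {P′ ψ′ a′ b′} → IsPillarAssignment S P′ ψ′ → Arch S P′ a′ b′ →
                AllPairs _<ℚ_ r → InsidePillars a′ b′ r → Inserted P′ ψ′ a′ b′ r)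
    (depth-l : suc (depth (length l)) ≤ depth (length (l ++ mid ∷ r)))
    (depth-r : suc (depth (length r)) ≤ depth (length (l ++ mid ∷ r))) where

    Qs : List ℚ
    Qs = l ++ mid ∷ r

    depthQs : ℕ
    depthQs = depth (length Qs)

    mid∈Qs : mid ∈ Qs
    mid∈Qs = ∈.∈-++⁺ʳ l (here refl)

    mid∈ab : InOpen a b mid
    mid∈ab = proj₁ (All.head (All.++⁻ʳ l inside))

    a<mid : a <ℚ mid
    a<mid = proj₁ mid∈ab

    mid<b : mid <ℚ b
    mid<b = proj₂ mid∈ab

    P-outside : All (λ z → ¬ InOpen a b z) P
    P-outside = proj₂ (proj₂ (proj₂ arch))

    sorted-l : AllPairs _<ℚ_ l
    sorted-l = proj₁ (AllPairs-split l sorted)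

    l<mid : All (_<ℚ mid) l
    l<mid = proj₁ (proj₂ (AllPairs-split l sorted))

    mid<r : All (mid <ℚ_) r
    mid<r = proj₁ (proj₂ (proj₂ (AllPairs-split l sorted)))

    sorted-r : AllPairs _<ℚ_ r
    sorted-r = proj₂ (proj₂ (proj₂ (AllPairs-split l sorted)))

    module Mid = OnePillar S ω ω-spec P ψ valid a b arch mid mid∈ab (proj₂ (All.head (All.++⁻ʳ l inside)))

    arch-l : Arch S (P ++ [ mid ]) a mid
    arch-l = a<mid , Sum.map₂ ∈.∈-++⁺ˡ (proj₁ (proj₂ arch)) , inj₂ (∈.∈-++⁺ʳ P (here refl)) ,
      All.++⁺ (All.map (_∘ InOpen-mono ℚ.≤-refl (ℚ.<⇒≤ mid<b)) P-outside) ((<ℚ-irrefl ∘ proj₂) ∷ [])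

    inside-l : InsidePillars a mid l
    inside-l = All.zipWith (λ (((a<z , _) , pillar) , z<mid) → (a<z , z<mid) , pillar)
      (All.++⁻ˡ l inside , l<mid)

    module Left = Inserted (insert-l Mid.ψ′-valid arch-l sorted-l inside-l)

    arch-r : Arch S ((P ++ [ mid ]) ++ Left.added) mid b
    arch-r = mid<b , inj₂ (∈.∈-++⁺ˡ (∈.∈-++⁺ʳ P (here refl))) ,
      Sum.map₂ (∈.∈-++⁺ˡ ∘ ∈.∈-++⁺ˡ) (proj₁ (proj₂ (proj₂ arch))) ,
      All.++⁺ (All.++⁺ (All.map (_∘ InOpen-mono (ℚ.<⇒≤ a<mid) ℚ.≤-refl) P-outside) ((<ℚ-irrefl ∘ proj₁) ∷ []))
              (All.tabulate λ z∈ (mid<z , _) →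
                 <ℚ-irrefl (ℚ.<-trans mid<z (All.lookup l<mid (Left.added⊆Qs z∈))))

    inside-r : InsidePillars mid b r
    inside-r = All.zipWith (λ (((_ , z<b) , pillar) , mid<z) → (mid<z , z<b) , pillar)
      (All.tail (All.++⁻ʳ l inside) , mid<r)

    module Right = Inserted (insert-r Left.ψ*-valid arch-r sorted-r inside-r)

    Mid-palette : ∀ {Y} → Recolouring Y ψ Mid.ψ′ (λ _ c → c ∈ Mid.palette)
    Mid-palette = recolouring-weaken (λ _ _ _ → proj₂) (recolouring-restrict Mid.ψ′-recolouring)

    degree-l : degree S Mid.ψ′ a mid ≤ degree S ψ a b + ω
    degree-l = ℕ.≤-trans
      (degree-≤ {ψ} {Mid.ψ′} {a} {mid} {a} {b} Mid.palette ℚ.≤-refl (ℚ.<⇒≤ mid<b) Mid-palette)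
      (ℕ.+-monoʳ-≤ _ Mid.length-palette≤ω)

    degree-r : degree S Left.ψ* mid b ≤ degree S ψ a b + ω
    degree-r = ℕ.≤-trans (degree-≤ {ψ} {Left.ψ*} {mid} {b} {a} {b} Mid.palette (ℚ.<⇒≤ a<mid) ℚ.≤-refl
                 (recolouring-weaken only-palette
                   (recolouring-restrict (recolouring-trans Mid.ψ′-recolouring Left.ψ*-fresh))))
               (ℕ.+-monoʳ-≤ _ Mid.length-palette≤ω)
      where
      only-palette : ∀ i c → EndsIn mid b i →
        ((a ≤ℚ L i × R i ≤ℚ b) × c ∈ Mid.palette) ⊎ FreshColour Mid.ψ′ a mid (depth (length l)) i c →
        c ∈ Mid.palette
      only-palette i c _    (inj₁ (_ , c∈)) = c∈
      only-palette i c ends (inj₂ (mkFresh (_ , Ri≤mid) _ _)) = ⊥-elim (¬EndsIn-rightOf ℚ.≤-refl Ri≤mid ends)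

    fresh : Recolouring (λ _ → ⊤) ψ Right.ψ* (FreshColour ψ a b depthQs)
    fresh = recolouring-weaken classify
      (recolouring-trans (recolouring-trans Mid.ψ′-recolouring Left.ψ*-fresh) Right.ψ*-fresh)
      where
      ω≤ω*depth : ω ≤ ω * depthQs
      ω≤ω*depth = subst (_≤ ω * depthQs) (ℕ.*-identityʳ ω) (ℕ.*-monoʳ-≤ ω (ℕ.≤-trans (s≤s z≤n) depth-l))
      classify : ∀ i c → ⊤ →
        (((a ≤ℚ L i × R i ≤ℚ b) × c ∈ Mid.palette) ⊎ FreshColour Mid.ψ′ a mid (depth (length l)) i c) ⊎
        FreshColour Left.ψ* mid b (depth (length r)) i c → FreshColour ψ a b depthQs i c
      classify i c _ (inj₁ (inj₁ (within , c∈))) = mkFresh within (proj₁ (Mid.palette-bounds c∈))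
        (ℕ.≤-trans (proj₂ (Mid.palette-bounds c∈)) (ℕ.+-monoʳ-≤ _ ω≤ω*depth))
      classify i c _ (inj₁ (inj₂ (mkFresh (a≤L , R≤mid) 1≤c c≤))) =
        mkFresh (a≤L , ℚ.≤-trans R≤mid (ℚ.<⇒≤ mid<b)) 1≤c (fresh-bound c≤ degree-l depth-l)
      classify i c _ (inj₂ (mkFresh (mid≤L , R≤b) 1≤c c≤)) =
        mkFresh (ℚ.≤-trans (ℚ.<⇒≤ a<mid) mid≤L , R≤b) 1≤c (fresh-bound c≤ degree-r depth-r)

    palette++-length : ∀ {t} (new : List ℕ) → length new ≤ ω * t → suc t ≤ depthQs →
                       length (Mid.palette ++ new) ≤ ω * depthQs
    palette++-length {t} new len≤ t<depthQs = begin
      length (Mid.palette ++ new)         ≡⟨ List.length-++ Mid.palette ⟩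
      length Mid.palette + length new     ≤⟨ ℕ.+-mono-≤ Mid.length-palette≤ω len≤ ⟩
      ω + ω * t                           ≤⟨ ω+ω*t≤ω*T ω t<depthQs ⟩
      ω * depthQs                         ∎
      where open ℕ.≤-Reasoning

    InsideMinus-l : ∀ {x y} → InsideMinus a b Qs x y → y ≤ℚ mid → InsideMinus a mid l x y
    InsideMinus-l {x} {y} x,y⊆ y≤mid z z∈xy with (a<z , _) , z∉Qs ← x,y⊆ z z∈xy =
      (a<z , ℚ.<-≤-trans (proj₂ z∈xy) y≤mid) , z∉Qs ∘ ∈.∈-++⁺ˡ

    InsideMinus-r : ∀ {x y} → InsideMinus a b Qs x y → mid ≤ℚ x → InsideMinus mid b r x y
    InsideMinus-r {x} {y} x,y⊆ mid≤x z z∈xy with (_ , z<b) , z∉Qs ← x,y⊆ z z∈xy =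
      (ℚ.≤-<-trans mid≤x (proj₁ z∈xy) , z<b) , z∉Qs ∘ ∈.∈-++⁺ʳ l ∘ there

    local-l : ∀ x y → InsideMinus a b Qs x y → y ≤ℚ mid → FewNewColours (ω * depthQs) x y ψ Right.ψ*
    local-l x y x,y⊆ y≤mid = extend (Left.ψ*-local x y (InsideMinus-l x,y⊆ y≤mid))
      where
      extend : FewNewColours (ω * depth (length l)) x y Mid.ψ′ Left.ψ* →
               FewNewColours (ω * depthQs) x y ψ Right.ψ*
      extend (new , len≤ , recoloured) =
        Mid.palette ++ new , palette++-length new len≤ depth-l ,
        recolouring-weaken classify
          (recolouring-trans (recolouring-trans Mid-palette recoloured) (recolouring-restrict Right.ψ*-fresh))
        where
        classify : ∀ i c → EndsIn x y i →
                   (c ∈ Mid.palette ⊎ c ∈ new) ⊎ FreshColour Left.ψ* mid b (depth (length r)) i c →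
                   c ∈ Mid.palette ++ new
        classify i c _    (inj₁ (inj₁ c∈)) = ∈.∈-++⁺ˡ c∈
        classify i c _    (inj₁ (inj₂ c∈)) = ∈.∈-++⁺ʳ Mid.palette c∈
        classify i c ends (inj₂ (mkFresh (mid≤L , _) _ _)) = ⊥-elim (¬EndsIn-leftOf y≤mid mid≤L ends)

    local-r : ∀ x y → InsideMinus a b Qs x y → mid ≤ℚ x → FewNewColours (ω * depthQs) x y ψ Right.ψ*
    local-r x y x,y⊆ mid≤x = extend (Right.ψ*-local x y (InsideMinus-r x,y⊆ mid≤x))
      where
      extend : FewNewColours (ω * depth (length r)) x y Left.ψ* Right.ψ* →
               FewNewColours (ω * depthQs) x y ψ Right.ψ*
      extend (new , len≤ , recoloured) =
        Mid.palette ++ new , palette++-length new len≤ depth-r ,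
        recolouring-weaken classify
          (recolouring-trans (recolouring-trans Mid-palette (recolouring-restrict Left.ψ*-fresh)) recoloured)
        where
        classify : ∀ i c → EndsIn x y i →
                   (c ∈ Mid.palette ⊎ FreshColour Mid.ψ′ a mid (depth (length l)) i c) ⊎ c ∈ new →
                   c ∈ Mid.palette ++ new
        classify i c _    (inj₁ (inj₁ c∈)) = ∈.∈-++⁺ˡ c∈
        classify i c ends (inj₁ (inj₂ (mkFresh (_ , R≤mid) _ _))) = ⊥-elim (¬EndsIn-rightOf mid≤x R≤mid ends)
        classify i c _    (inj₂ c∈) = ∈.∈-++⁺ʳ Mid.palette c∈

    local : ∀ x y → InsideMinus a b Qs x y → FewNewColours (ω * depthQs) x y ψ Right.ψ*
    local x y x,y⊆ = by-side (x <ℚ? mid)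
      where
      by-side : Dec (x <ℚ mid) → FewNewColours (ω * depthQs) x y ψ Right.ψ*
      by-side (yes x<mid) = local-l x y x,y⊆ (ℚ.≮⇒≥ λ mid<y → proj₂ (x,y⊆ mid (x<mid , mid<y)) mid∈Qs)
      by-side (no  x≮mid) = local-r x y x,y⊆ (ℚ.≮⇒≥ x≮mid)

    added : List ℚ
    added = mid ∷ (Left.added ++ Right.added)

    added⊆Qs : added ⊆ Qs
    added⊆Qs (here refl) = mid∈Qs
    added⊆Qs (there z∈)  =
      [ ∈.∈-++⁺ˡ ∘ Left.added⊆Qs , ∈.∈-++⁺ʳ l ∘ there ∘ Right.added⊆Qs ]′ (∈.∈-++⁻ Left.added z∈)

    mid∷r⊆added : mid ∷ r ⊆ added
    mid∷r⊆added (here refl) = here refl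
    mid∷r⊆added (there z∈r) = there (∈.∈-++⁺ʳ Left.added (Right.Qs⊆added z∈r))

    Qs⊆added : Qs ⊆ added
    Qs⊆added = [ there ∘ ∈.∈-++⁺ˡ ∘ Left.Qs⊆added , mid∷r⊆added ]′ ∘ ∈.∈-++⁻ l

    inserted : Inserted P ψ a b Qs
    inserted = record
      { added      = added
      ; ψ*         = Right.ψ*
      ; ψ*-valid   = subst (λ P′ → IsPillarAssignment S P′ Right.ψ*)
          (trans (List.++-assoc (P ++ [ mid ]) Left.added Right.added)
                 (List.++-assoc P [ mid ] (Left.added ++ Right.added)))
          Right.ψ*-valid
      ; added⊆Qs   = added⊆Qs
      ; Qs⊆added   = Qs⊆added
      ; ψ*-extends = λ i c → Right.ψ*-extends i c ∘ Left.ψ*-extends i c ∘ Mid.ψ′-extends i c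
      ; ψ*-fresh   = fresh
      ; ψ*-local   = local
      }

  Insertable : ℕ → Set₁
  Insertable m = ∀ {P ψ a b} → IsPillarAssignment S P ψ → Arch S P a b → (Qs : List ℚ) →
                 AllPairs _<ℚ_ Qs → InsidePillars a b Qs → length Qs ≡ m → Inserted P ψ a b Qs

  insert : ∀ m → Insertable m
  insert = <-rec Insertable insert-halves
    where
    insert-halves : ∀ m → (∀ {m′} → m′ < m → Insertable m′) → Insertable m
    insert-halves zero    _       valid arch []      _      _      _   = insert-nothing valid _ _
    insert-halves (suc m) recurse valid arch Qs      sorted inside len
      with l , mid , r , refl , len-l ←
             split-at ⌊ m /2⌋ Qs (subst (⌊ m /2⌋ <_) (sym len) (s≤s (ℕ.⌊n/2⌋≤n m))) =
      Combine.inserted valid arch l mid r sorted inside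
        (λ valid′ arch′ sorted′ inside′ → recurse (s≤s (subst (_≤ m) (sym len-l) (ℕ.⌊n/2⌋≤n m)))
                                            valid′ arch′ l sorted′ inside′ refl)
        (λ valid′ arch′ sorted′ inside′ → recurse (s≤s (subst (_≤ m) (sym len-r) (ℕ.⌈n/2⌉≤n m)))
                                            valid′ arch′ r sorted′ inside′ refl)
        (subst₂ (λ u v → suc (depth u) ≤ depth v) (sym len-l) (sym len) (depth-suc-⌊/2⌋ m))
        (subst₂ (λ u v → suc (depth u) ≤ depth v) (sym len-r) (sym len) (ℕ.≤-reflexive (depth-suc-⌈/2⌉ m)))
      where
      len-r : length r ≡ ⌈ m /2⌉
      len-r = ℕ.+-cancelˡ-≡ ⌊ m /2⌋ _ _ (begin
        ⌊ m /2⌋ + length r            ≡⟨ cong (_+ length r) len-l ⟨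
        length l + length r           ≡⟨ ℕ.suc-injective (trans (sym (ℕ.+-suc (length l) (length r)))
                                                                 (trans (sym (List.length-++ l)) len)) ⟩
        m                             ≡⟨ ℕ.⌊n/2⌋+⌈n/2⌉≡n m ⟨
        ⌊ m /2⌋ + ⌈ m /2⌉             ∎)
        where open ≡-Reasoning

  module _ {P ψ a b Qs} (inserted : Inserted P ψ a b Qs) where
    open Inserted inserted

    Inserted-degree : ∀ {x y t} → InsideMinus a b Qs x y → degree S ψ x y ≤ t →
                      degree S ψ* x y ≤ t + ω * depth (length Qs)
    Inserted-degree {x} {y} x,y⊆ degree≤t with new , len≤ , recoloured ← ψ*-local x y x,y⊆ =
      ℕ.≤-trans (degree-≤ {ψ} {ψ*} {x} {y} {x} {y} new ℚ.≤-refl ℚ.≤-refl recoloured)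
                (ℕ.+-mono-≤ degree≤t len≤)

    Inserted-χ : IsPillarAssignment S P ψ → χ S ψ* ≤ χ S ψ ⊔ (degree S ψ a b + ω * depth (length Qs))
    Inserted-χ valid = length≤-of-bounded _ (Unique.deduplicate-! ℕ._≟_ _) λ c∈ →
      let i , _ , ψ*i≡c = ∈-mapMaybe⁻ ψ* (allFin n) (∈.∈-deduplicate⁻ ℕ._≟_ _ c∈) in
      [ (λ ψi≡c → Product.map₂ (ℕ.m≤n⇒m≤n⊔o _) (Assignments.colour≤χ S valid ψi≡c))
      , (λ (mkFresh _ 1≤c c≤) → 1≤c , ℕ.m≤n⇒m≤o⊔n (χ S ψ) c≤) ]′ (ψ*-fresh i _ tt ψ*i≡c)

    Inserted-members : ∀ z → (z ∈ P ++ added) ⇔ (z ∈ P ⊎ z ∈ Qs)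
    Inserted-members z = mk⇔ (Sum.map₂ added⊆Qs ∘ ∈.∈-++⁻ P) [ ∈.∈-++⁺ˡ , ∈.∈-++⁺ʳ P ∘ Qs⊆added ]′

  Inserted-↭ : ∀ {P ψ a b Qs Q} → Qs ↭ Q → Inserted P ψ a b Qs → Inserted P ψ a b Q
  Inserted-↭ {P} {ψ} {a} {b} {Qs} {Q} Qs↭Q inserted = record
    { added      = added
    ; ψ*         = ψ*
    ; ψ*-valid   = ψ*-valid
    ; added⊆Qs   = ↭.∈-resp-↭ Qs↭Q ∘ added⊆Qs
    ; Qs⊆added   = Qs⊆added ∘ ↭.∈-resp-↭ (↭-sym Qs↭Q)
    ; ψ*-extends = ψ*-extends
    ; ψ*-fresh   = subst (λ m → Recolouring (λ _ → ⊤) ψ ψ* (FreshColour ψ a b (depth m))) same-length ψ*-fresh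
    ; ψ*-local   = λ x y x,y⊆ →
        let new , len≤ , recoloured = ψ*-local x y λ z z∈ → Product.map₂ (_∘ ↭.∈-resp-↭ Qs↭Q) (x,y⊆ z z∈) in
        new , subst (λ m → length new ≤ ω * depth m) same-length len≤ , recoloured
    }
    where
    open Inserted inserted
    same-length : length Qs ≡ length Q
    same-length = ↭.↭-length Qs↭Q

  insert-unique : ∀ {P ψ a b Q} → IsPillarAssignment S P ψ → Arch S P a b → Unique Q → InsidePillars a b Q →
                  Inserted P ψ a b Q
  insert-unique {Q = Q} valid arch Q! inside = Inserted-↭ (sort-↭ Q)
    (insert _ valid arch (sort Q) (sort-strict Q!) (↭.All-resp-↭ (↭-sym (sort-↭ Q)) inside) refl)

lemma7 : (S : IntervalSystem) (ω : ℕ) → IsOmega S (λ _ → ⊤) ω →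
    (P : List ℚ) (ψ : Colouring S) → IsPillarAssignment S P ψ →
    (a b : ℚ) → Arch S P a b →
    (t : ℕ) → 1 ≤ t →
    (Q : List ℚ) → Unique Q → All (λ q → InOpen a b q × Pillar S q) Q →
    (∀ x y → InsideMinus a b Q x y → degree S ψ x y ≤ t) →
    Σ (List ℚ) λ P* → Σ (Colouring S) λ ψ* →
      IsPillarAssignment S P* ψ* × Extends S P ψ P* ψ* ×
      (∀ z → (z ∈ P*) ⇔ (z ∈ P ⊎ z ∈ Q)) ×
      (∀ x y → InsideMinus a b Q x y →
        degree S ψ* x y ≤ t + ω * ⌈log₂ (length Q + 1) ⌉) ×
      (χ S ψ* ≤ χ S ψ ⊔ (degree S ψ a b + ω * ⌈log₂ (length Q + 1) ⌉))
lemma7 S ω ω-spec P ψ valid a b arch t _ Q Q! Q-inside degree≤t =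
  P ++ added , ψ* , ψ*-valid , ((added , refl) , ψ*-extends) , Inserted-members inserted ,
  (λ x y x,y⊆ → Inserted-degree inserted x,y⊆ (degree≤t x y x,y⊆)) , Inserted-χ inserted valid
  where
  open Insertion S ω ω-spec
  inserted : Inserted P ψ a b Q
  inserted = insert-unique valid arch Q! Q-inside
  open Inserted inserted
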